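{- Let $A_0,\dots,A_{n-1}$ be overlapping Boolean algebras such that for every $m<n$: (a) $A_m$ commutatively reflects $(A_i)_{i<m}$, and (b) the subalgebras $(A_i\cap A_m)_{i<m}$ commute in $A_m$. Then there are Boolean algebras $B_m$ for $m\le n$ such that each $B_m$, together with the inclusion maps $A_i\to B_m$ ($i<m$), is a pushout of $(A_i)_{i<m}$, and $A_i\le B_j$ and $B_i\le B_j$ for all $i<j\le n$.
   Context: Boolean algebras $(A_i)_{i<n}$ overlap if for all $i,j$ each Boolean operation of $A_i$ (including the constants $0,1$), restricted to $A_i\cap A_j$, equals the corresponding restricted operation of $A_j$; in particular $A_i\cap A_j$ is a common subalgebra. Pushout: for overlapping $(A_i)_{i<m}$, a pushout $\boxplus_{i<m}A_i$ is a colimit, with coprojections $\iota_i\colon A_i\to\boxplus_{i<m}A_i$, of the diagram of inclusions $\bigcap_{i\in t}A_i\to\bigcap_{i\in s}A_i$ for $\emptyset\ne s\subseteq t\subseteq m$. Concretely it may be taken as the quotient of the free product $\bigoplus_{i<m}A_i$ by the ideal generated by the elements $c_i(x)\wedge c_j(-x)$ for $x\in A_i\cap A_j$ ($c_i$ the cofactor maps), with $\iota_i(x)$ the class of $c_i(x)$. Commuting: subalgebras $C_0,\dots,C_{k-1}$ of a Boolean algebra $D$ commute in $D$ if the unique homomorphism $\boxplus_{i<k}C_i\to D$ extending the inclusions $C_i\to D$ is injective. Commutative reflection: a set $M$ commutatively reflects overlapping $(A_i)_{i<m}$ if (1) $A_i\cap M$ is a subalgebra of $A_i$ for every $i<m$;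 (2) the subalgebras $(\iota_i[A_i\cap M])_{i<m}$ commute in $\boxplus_{i<m}A_i$; and (3) for each $i<m$, $\iota_i[A_i]\cap\langle\bigcup_{j<m}\iota_j[A_j\cap M]\rangle=\iota_i[A_i\cap M]$ in $\boxplus_{i<m}A_i$, where $\langle S\rangle$ denotes the generated subalgebra. -}

module Defs where

open import Level using (0ℓ)
open import Data.Nat using (ℕ; _<_; _≤_)
open import Data.Fin using (Fin; toℕ; inject≤)
open import Data.Product using (Σ; Σ-syntax; ∃; ∃-syntax; _×_; _,_; proj₁; proj₂)
open import Data.Unit using () renaming (⊤ to Unit)
open import Relation.Binary.Bundles using (Setoid)
open import Algebra.Lattice.Bundles using (BooleanAlgebra)
open import Algebra.Lattice.Structures using (IsBooleanAlgebra)

-- Sets are modelled by setoids (no quotients in Agda).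
-- A Boolean algebra "living inside" an ambient setoid U is a subset
-- `mem` of U (closed under ≈) together with Boolean operations on it
-- satisfying the Boolean algebra axioms w.r.t. the equality inherited
-- from U.  Overlapping families of Boolean algebras are families of
-- such objects over a common ambient U.

record OnSub (U : Setoid 0ℓ 0ℓ) : Set₁ where
  open Setoid U using () renaming (Carrier to |U|; _≈_ to _≈ᵤ_)
  field
    mem      : |U| → Set
    mem-resp : ∀ {x y} → x ≈ᵤ y → mem x → mem y

  Elem : Set
  Elem = Σ |U| mem

  _≈ₑ_ : Elem → Elem → Set
  a ≈ₑ b = proj₁ a ≈ᵤ proj₁ b

  field
    _∨_ _∧_  : Elem → Elem → Elem
    ¬_       : Elem → Elem
    top bot  : Elem
    isBooleanAlgebra : IsBooleanAlgebra _≈ₑ_ _∨_ _∧_ ¬_ top bot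

open OnSub public using (mem; Elem)

toBA : {U : Setoid 0ℓ 0ℓ} → OnSub U → BooleanAlgebra 0ℓ 0ℓ
toBA A = record
  { Carrier = OnSub.Elem A
  ; _≈_ = OnSub._≈ₑ_ A
  ; _∨_ = OnSub._∨_ A
  ; _∧_ = OnSub._∧_ A
  ; ¬_ = OnSub.¬_ A
  ; ⊤ = OnSub.top A
  ; ⊥ = OnSub.bot A
  ; isBooleanAlgebra = OnSub.isBooleanAlgebra A
  }

module _ {U : Setoid 0ℓ 0ℓ} where
  open Setoid U renaming (Carrier to |U|)

  record Overlap (A B : OnSub U) : Set where
    field
      ∨-agree : ∀ x y (xa : mem A x) (xb : mem B x) (ya : mem A y) (yb : mem B y) →
                proj₁ (OnSub._∨_ A (x , xa) (y , ya)) ≈ proj₁ (OnSub._∨_ B (x , xb) (y , yb))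
      ∧-agree : ∀ x y (xa : mem A x) (xb : mem B x) (ya : mem A y) (yb : mem B y) →
                proj₁ (OnSub._∧_ A (x , xa) (y , ya)) ≈ proj₁ (OnSub._∧_ B (x , xb) (y , yb))
      ¬-agree : ∀ x (xa : mem A x) (xb : mem B x) →
                proj₁ (OnSub.¬_ A (x , xa)) ≈ proj₁ (OnSub.¬_ B (x , xb))
      top-agree : proj₁ (OnSub.top A) ≈ proj₁ (OnSub.top B)
      bot-agree : proj₁ (OnSub.bot A) ≈ proj₁ (OnSub.bot B)

  Overlapping : {k : ℕ} → (Fin k → OnSub U) → Set
  Overlapping {k} F = ∀ (i j : Fin k) → Overlap (F i) (F j)

record IsHom (A B : BooleanAlgebra 0ℓ 0ℓ)
             (f : BooleanAlgebra.Carrier A → BooleanAlgebra.Carrier B) : Set where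
  module A = BooleanAlgebra A
  module B = BooleanAlgebra B
  field
    cong : ∀ {x y} → x A.≈ y → f x B.≈ f y
    ∨-hom : ∀ x y → f (x A.∨ y) B.≈ (f x B.∨ f y)
    ∧-hom : ∀ x y → f (x A.∧ y) B.≈ (f x B.∧ f y)
    ¬-hom : ∀ x → f (A.¬ x) B.≈ (B.¬ f x)
    ⊤-hom : f A.⊤ B.≈ B.⊤
    ⊥-hom : f A.⊥ B.≈ B.⊥

-- A cocone over the
-- diagram of inclusions ⋂_{i∈t} A_i → ⋂_{i∈s} A_i is the same as a family
-- of homomorphisms ι_i : A_i → P agreeing on pairwise intersections.

module _ {U : Setoid 0ℓ 0ℓ} {k : ℕ} (F : Fin k → OnSub U) where

  IsCocone : (C : BooleanAlgebra 0ℓ 0ℓ) →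
             ((i : Fin k) → Elem (F i) → BooleanAlgebra.Carrier C) → Set
  IsCocone C f =
    (∀ i → IsHom (toBA (F i)) C (f i)) ×
    (∀ i j x (p : mem (F i) x) (q : mem (F j) x) →
       BooleanAlgebra._≈_ C (f i (x , p)) (f j (x , q)))

  record IsPushout (P : BooleanAlgebra 0ℓ 0ℓ)
                   (ι : (i : Fin k) → Elem (F i) → BooleanAlgebra.Carrier P) : Set₁ where
    field
      cocone : IsCocone P ι
      factor : ∀ (C : BooleanAlgebra 0ℓ 0ℓ)
                 (f : (i : Fin k) → Elem (F i) → BooleanAlgebra.Carrier C) →
               IsCocone C f →
               Σ[ h ∈ (BooleanAlgebra.Carrier P → BooleanAlgebra.Carrier C) ]
                 (IsHom P C h ×
                  (∀ i a → BooleanAlgebra._≈_ C (h (ι i a)) (f i a)))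
      unique : ∀ (C : BooleanAlgebra 0ℓ 0ℓ)
                 (f : (i : Fin k) → Elem (F i) → BooleanAlgebra.Carrier C)
                 (h h′ : BooleanAlgebra.Carrier P → BooleanAlgebra.Carrier C) →
               IsHom P C h → IsHom P C h′ →
               (∀ i a → BooleanAlgebra._≈_ C (h (ι i a)) (f i a)) →
               (∀ i a → BooleanAlgebra._≈_ C (h′ (ι i a)) (f i a)) →
               ∀ y → BooleanAlgebra._≈_ C (h y) (h′ y)

module _ (D : BooleanAlgebra 0ℓ 0ℓ) where
  open BooleanAlgebra D

  record IsSubalgebra (S : Carrier → Set) : Set where
    field
      resp : ∀ {x y} → x ≈ y → S x → S y
      ⊤-in : S ⊤
      ⊥-in : S ⊥
      ∨-in : ∀ {x y} → S x → S y → S (x ∨ y)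
      ∧-in : ∀ {x y} → S x → S y → S (x ∧ y)
      ¬-in : ∀ {x} → S x → S (¬ x)

  data Gen (S : Carrier → Set) : Carrier → Set where
    gen-base : ∀ {x} → S x → Gen S x
    gen-resp : ∀ {x y} → x ≈ y → Gen S x → Gen S y
    gen-⊤-in : Gen S ⊤
    gen-⊥-in : Gen S ⊥
    gen-∨-in : ∀ {x y} → Gen S x → Gen S y → Gen S (x ∨ y)
    gen-∧-in : ∀ {x y} → Gen S x → Gen S y → Gen S (x ∧ y)
    gen-¬-in : ∀ {x} → Gen S x → Gen S (¬ x)

  subOnSub : (S : Carrier → Set) → IsSubalgebra S → OnSub setoid
  subOnSub S sub = record
    { mem = S
    ; mem-resp = IsSubalgebra.resp sub
    ; _∨_ = λ a b → (proj₁ a ∨ proj₁ b) , IsSubalgebra.∨-in sub (proj₂ a) (proj₂ b)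
    ; _∧_ = λ a b → (proj₁ a ∧ proj₁ b) , IsSubalgebra.∧-in sub (proj₂ a) (proj₂ b)
    ; ¬_ = λ a → (¬ proj₁ a) , IsSubalgebra.¬-in sub (proj₂ a)
    ; top = ⊤ , IsSubalgebra.⊤-in sub
    ; bot = ⊥ , IsSubalgebra.⊥-in sub
    ; isBooleanAlgebra = record
      { isDistributiveLattice = record
        { isLattice = record
          { isEquivalence = record { refl = refl ; sym = sym ; trans = trans }
          ; ∨-comm = λ a b → ∨-comm (proj₁ a) (proj₁ b)
          ; ∨-assoc = λ a b c → ∨-assoc (proj₁ a) (proj₁ b) (proj₁ c)
          ; ∨-cong = ∨-cong
          ; ∧-comm = λ a b → ∧-comm (proj₁ a) (proj₁ b)
          ; ∧-assoc = λ a b c → ∧-assoc (proj₁ a) (proj₁ b) (proj₁ c)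
          ; ∧-cong = ∧-cong
          ; absorptive = (λ a b → ∨-absorbs-∧ (proj₁ a) (proj₁ b))
                       , (λ a b → ∧-absorbs-∨ (proj₁ a) (proj₁ b))
          }
        ; ∨-distrib-∧ = (λ a b c → ∨-distribˡ-∧ (proj₁ a) (proj₁ b) (proj₁ c))
                      , (λ a b c → ∨-distribʳ-∧ (proj₁ a) (proj₁ b) (proj₁ c))
        ; ∧-distrib-∨ = (λ a b c → ∧-distribˡ-∨ (proj₁ a) (proj₁ b) (proj₁ c))
                      , (λ a b c → ∧-distribʳ-∨ (proj₁ a) (proj₁ b) (proj₁ c))
        }
      ; ∨-complement = (λ a → ∨-complementˡ (proj₁ a)) , (λ a → ∨-complementʳ (proj₁ a))
      ; ∧-complement = (λ a → ∧-complementˡ (proj₁ a)) , (λ a → ∧-complementʳ (proj₁ a))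
      ; ¬-cong = ¬-cong
      }
    }

  -- Subalgebras C_0,…,C_{k-1} of D commute in D: they are subalgebras and
  -- the (unique) homomorphism from their pushout to D extending the
  -- inclusions is injective.  (Stated for every pushout; pushouts are
  -- unique up to isomorphism.)
  Commute : {k : ℕ} → (Fin k → Carrier → Set) → Set₁
  Commute {k} C =
    Σ[ sub ∈ (∀ i → IsSubalgebra (C i)) ]
      (∀ (P : BooleanAlgebra 0ℓ 0ℓ)
         (κ : (i : Fin k) → Elem (subOnSub (C i) (sub i)) → BooleanAlgebra.Carrier P) →
       IsPushout (λ i → subOnSub (C i) (sub i)) P κ →
       ∀ (h : BooleanAlgebra.Carrier P → Carrier) → IsHom P D h →
       (∀ i a → h (κ i a) ≈ proj₁ a) →
       ∀ y y′ → h y ≈ h y′ → BooleanAlgebra._≈_ P y y′)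

module _ {U : Setoid 0ℓ 0ℓ} where
  open Setoid U renaming (Carrier to |U|)

  record IsSubalgebraOf (A : OnSub U) (M : |U| → Set) : Set where
    field
      top-in : M (proj₁ (OnSub.top A))
      bot-in : M (proj₁ (OnSub.bot A))
      ∨-in : ∀ (a b : Elem A) → M (proj₁ a) → M (proj₁ b) → M (proj₁ (OnSub._∨_ A a b))
      ∧-in : ∀ (a b : Elem A) → M (proj₁ a) → M (proj₁ b) → M (proj₁ (OnSub._∧_ A a b))
      ¬-in : ∀ (a : Elem A) → M (proj₁ a) → M (proj₁ (OnSub.¬_ A a))

  Img : (A : OnSub U) (P : BooleanAlgebra 0ℓ 0ℓ) →
        (Elem A → BooleanAlgebra.Carrier P) → (|U| → Set) →
        BooleanAlgebra.Carrier P → Set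
  Img A P ι T y = Σ[ x ∈ |U| ] Σ[ p ∈ mem A x ] (T x × BooleanAlgebra._≈_ P (ι (x , p)) y)

  CommReflects : {k : ℕ} → (Fin k → OnSub U) → (|U| → Set) → Set₁
  CommReflects {k} A M =
    (∀ i → IsSubalgebraOf (A i) M) ×
    (∀ (P : BooleanAlgebra 0ℓ 0ℓ)
       (ι : (i : Fin k) → Elem (A i) → BooleanAlgebra.Carrier P) →
     IsPushout A P ι →
       Commute P (λ i → Img (A i) P (ι i) M)
       × (∀ i y →
           ((Img (A i) P (ι i) (λ _ → Unit) y ×
             Gen P (λ z → Σ[ j ∈ Fin k ] Img (A j) P (ι j) M z) y)
            → Img (A i) P (ι i) M y)
           × (Img (A i) P (ι i) M y →
              (Img (A i) P (ι i) (λ _ → Unit) y ×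
               Gen P (λ z → Σ[ j ∈ Fin k ] Img (A j) P (ι j) M z) y))))

-- A ≤ B (A a subalgebra of B) along a map f of ambient setoids
-- (f = identity for B_i ≤ B_j; f = the embedding of the old ambient into
-- the new one for A_i ≤ B_j).

module _ {U V : Setoid 0ℓ 0ℓ} where
  open Setoid V renaming (_≈_ to _≈ᵥ_)

  record SubAlgVia (f : Setoid.Carrier U → Setoid.Carrier V)
                   (A : OnSub U) (B : OnSub V) : Set where
    field
      incl : ∀ x → mem A x → mem B (f x)

    inc : Elem A → Elem B
    inc a = f (proj₁ a) , incl (proj₁ a) (proj₂ a)

    field
      ∨-pres : ∀ a b → proj₁ (inc (OnSub._∨_ A a b)) ≈ᵥ proj₁ (OnSub._∨_ B (inc a) (inc b))
      ∧-pres : ∀ a b → proj₁ (inc (OnSub._∧_ A a b)) ≈ᵥ proj₁ (OnSub._∧_ B (inc a) (inc b))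
      ¬-pres : ∀ a → proj₁ (inc (OnSub.¬_ A a)) ≈ᵥ proj₁ (OnSub.¬_ B (inc a))
      top-pres : proj₁ (inc (OnSub.top A)) ≈ᵥ proj₁ (OnSub.top B)
      bot-pres : proj₁ (inc (OnSub.bot A)) ≈ᵥ proj₁ (OnSub.bot B)

restrict : {X : Set₁} {m n : ℕ} → (Fin n → X) → .(m ≤ n) → Fin m → X
restrict F m≤n i = F (inject≤ i m≤n)

module Submission where

-- The Bₘ are built by induction on m, together with pushouts whose coprojections are jointly
-- injective.  Given such a pushout P of A₀,…,Aₘ₋₁, let K be the pushout of the Aᵢ ∩ Aₘ.  By (a)(2)
-- K embeds into P (onto the subalgebra generated by the ιᵢ[Aᵢ ∩ Aₘ]) and by (b) it embeds into Aₘ.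
-- The amalgamated free product of P and Aₘ over K is a pushout of A₀,…,Aₘ, and by the amalgamation
-- property of Boolean algebras both P and Aₘ embed into it.  By (a)(3) a point of some Aᵢ and a point
-- of Aₘ are identified there only when they are equal.  Finally every stage embeds into the last one,
-- which glued to the ambient set along the coprojections is the common universe of the Bₘ.

open import Defs
open import Level using (0ℓ)
open import Data.Nat using (ℕ; zero; suc; _<_; _≤_; _≤′_; ≤′-refl; ≤′-step; _≤?_; z≤n)
import Data.Nat.Properties as ℕ
open import Data.Nat.Properties using (<⇒≤)
open import Data.Fin using (Fin; toℕ; inject₁; fromℕ; fromℕ<)
open import Data.Fin.Properties using (toℕ<n; toℕ-injective; toℕ-inject≤; toℕ-inject₁; toℕ-fromℕ; toℕ-fromℕ<)
open import Data.Fin.Relation.Unary.Top using (View; view; ‵fromℕ; ‵inject₁; view-fromℕ; view-inject₁)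
open import Data.Bool using (Bool; true; false; if_then_else_)
import Data.Bool.Properties as Bool
open import Data.Empty using (⊥-elim)
open import Data.Unit using (tt) renaming (⊤ to Unit)
open import Data.Product using (Σ; Σ-syntax; _×_; _,_; proj₁; proj₂)
open import Data.Sum using (_⊎_; inj₁; inj₂)
open import Data.List using (List; []; _∷_; _++_; map; cartesianProductWith; [_])
open import Data.List.Relation.Unary.Any using (here; there)
open import Data.List.Membership.Propositional using (_∈_)
open import Data.List.Membership.Propositional.Properties using (∈-++⁺ˡ; ∈-++⁺ʳ; ∈-++⁻; ∈-map⁺; ∈-map⁻; ∈-cartesianProductWith⁺; ∈-cartesianProductWith⁻)
open import Function using (id; _∘_)
open import Function.Bundles using (Injection)
open import Relation.Binary.Bundles using (Setoid)
open import Relation.Binary.PropositionalEquality as ≡ using (_≡_; refl; cong; subst)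
open import Relation.Nullary using (Dec; yes; no)
open import Relation.Nullary.Decidable using (recompute)
open import Algebra.Bundles using (CommutativeMonoid)
open import Algebra.Lattice.Bundles using (BooleanAlgebra)
import Algebra.Properties.CommutativeSemigroup as CommutativeSemigroupProperties
import Algebra.Lattice.Properties.Lattice as LatticeProperties
import Algebra.Lattice.Properties.BooleanAlgebra as BooleanAlgebraProperties
import Relation.Binary.Lattice as Order
import Relation.Binary.Lattice.Properties.Lattice as OrderLatticeProperties
import Relation.Binary.Lattice.Properties.MeetSemilattice as MeetProperties
import Relation.Binary.Lattice.Properties.JoinSemilattice as JoinProperties
import Relation.Binary.Lattice.Properties.DistributiveLattice as DistributiveProperties
import Relation.Binary.Reasoning.Setoid as SetoidReasoning

module BooleanOrder (B : BooleanAlgebra 0ℓ 0ℓ) where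
  open BooleanAlgebra B public
  open BooleanAlgebraProperties B public
    using (∧-identityʳ; ∧-identityˡ; ∨-identityʳ; ∨-identityˡ; ∧-zeroʳ; ∧-zeroˡ;
           deMorgan₁; deMorgan₂; ¬-involutive; ¬⊥≈⊤; ¬⊤≈⊥)
  open LatticeProperties lattice public using (∧-idem)

  private
    ∧-commutativeMonoid : CommutativeMonoid 0ℓ 0ℓ
    ∧-commutativeMonoid = record { isCommutativeMonoid = BooleanAlgebraProperties.∧-⊤-isCommutativeMonoid B }

  open CommutativeSemigroupProperties (CommutativeMonoid.commutativeSemigroup ∧-commutativeMonoid) public
    using () renaming (interchange to ∧-interchange)

  private
    order : Order.Lattice 0ℓ 0ℓ 0ℓ
    order = LatticeProperties.∨-∧-orderTheoreticLattice lattice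
    module O = Order.Lattice order

  open O public
    using (_≤_; x≤x∨y; y≤x∨y; ∨-least; x∧y≤x; x∧y≤y; ∧-greatest)
    renaming (refl to ≤-refl; trans to ≤-trans; antisym to ≤-antisym; reflexive to ≤-reflexive)
  open MeetProperties (Order.Lattice.meetSemilattice order) public using (∧-monotonic)
  open JoinProperties (Order.Lattice.joinSemilattice order) public using (∨-monotonic)

  -- ℕ's _≤_ is in scope as well, hence O._≤_ in the statements below.
  ≤-resp : ∀ {x x′ y y′} → x ≈ x′ → y ≈ y′ → x O.≤ y → x′ O.≤ y′
  ≤-resp x≈x′ y≈y′ x≤y = ≤-trans (≤-reflexive (sym x≈x′)) (≤-trans x≤y (≤-reflexive y≈y′))

  x≤⊤ : ∀ x → x O.≤ ⊤
  x≤⊤ x = sym (∧-identityʳ x)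

  ⊥≤x : ∀ x → ⊥ O.≤ x
  ⊥≤x x = sym (∧-zeroˡ x)

  x∧¬x≤⊥ : ∀ x → x ∧ ¬ x O.≤ ⊥
  x∧¬x≤⊥ x = ≤-reflexive (∧-complementʳ x)

  x≤[x∧a]∨[x∧¬a] : ∀ x a → x O.≤ (x ∧ a) ∨ (x ∧ ¬ a)
  x≤[x∧a]∨[x∧¬a] x a = ≤-reflexive (begin
    x                   ≈⟨ sym (∧-identityʳ x) ⟩
    x ∧ ⊤               ≈⟨ ∧-congˡ (sym (∨-complementʳ a)) ⟩
    x ∧ (a ∨ ¬ a)       ≈⟨ ∧-distribˡ-∨ x a (¬ a) ⟩
    (x ∧ a) ∨ (x ∧ ¬ a) ∎)
    where open SetoidReasoning setoid

  x∧¬y≤⊥⇒x≤y : ∀ {x y} → x ∧ ¬ y O.≤ ⊥ → x O.≤ y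
  x∧¬y≤⊥⇒x≤y {x} {y} x∧¬y≤⊥ =
    ≤-trans (x≤[x∧a]∨[x∧¬a] x y) (∨-least (x∧y≤y _ _) (≤-trans x∧¬y≤⊥ (⊥≤x _)))

  ¬-antitone : ∀ {x y} → x O.≤ y → ¬ y O.≤ ¬ x
  ¬-antitone {x} {y} x≤y =
    ≤-trans (x≤[x∧a]∨[x∧¬a] (¬ y) x)
      (∨-least (≤-trans (∧-greatest (≤-trans (x∧y≤y _ _) x≤y) (x∧y≤x _ _))
                        (≤-trans (x∧¬x≤⊥ y) (⊥≤x _)))
               (x∧y≤y _ _))

  ¬-reflects-≤ : ∀ {x y} → ¬ x O.≤ ¬ y → y O.≤ x
  ¬-reflects-≤ {x} {y} ¬x≤¬y = ≤-resp (¬-involutive y) (¬-involutive x) (¬-antitone ¬x≤¬y)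

  ¬x≤y⇒¬y≤x : ∀ {x y} → ¬ x O.≤ y → ¬ y O.≤ x
  ¬x≤y⇒¬y≤x {x} ¬x≤y = ≤-trans (¬-antitone ¬x≤y) (≤-reflexive (¬-involutive x))

module _ {A B : BooleanAlgebra 0ℓ 0ℓ} where
  private
    module A = BooleanAlgebra A
    module B = BooleanAlgebra B

  IsHom-resp : ∀ {f g} → IsHom A B f → (∀ x → g x B.≈ f x) → IsHom A B g
  IsHom-resp f-hom g≈f = record
    { cong  = λ x≈y → B.trans (g≈f _) (B.trans (F.cong x≈y) (B.sym (g≈f _)))
    ; ∨-hom = λ x y → B.trans (g≈f _) (B.trans (F.∨-hom x y) (B.sym (B.∨-cong (g≈f x) (g≈f y))))
    ; ∧-hom = λ x y → B.trans (g≈f _) (B.trans (F.∧-hom x y) (B.sym (B.∧-cong (g≈f x) (g≈f y))))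
    ; ¬-hom = λ x → B.trans (g≈f _) (B.trans (F.¬-hom x) (B.sym (B.¬-cong (g≈f x))))
    ; ⊤-hom = B.trans (g≈f _) F.⊤-hom
    ; ⊥-hom = B.trans (g≈f _) F.⊥-hom
    }
    where module F = IsHom f-hom

  IsHom-inverse : ∀ {f g} → IsHom A B f → (∀ y → f (g y) B.≈ y) →
                  (∀ {x x′} → f x B.≈ f x′ → x A.≈ x′) → IsHom B A g
  IsHom-inverse {f} {g} f-hom fg≈id f-injective = record
    { cong  = λ x≈y → f-injective (B.trans (fg≈id _) (B.trans x≈y (B.sym (fg≈id _))))
    ; ∨-hom = λ x y → f-injective (B.trans (fg≈id _) (B.sym (B.trans (F.∨-hom _ _) (B.∨-cong (fg≈id x) (fg≈id y)))))
    ; ∧-hom = λ x y → f-injective (B.trans (fg≈id _) (B.sym (B.trans (F.∧-hom _ _) (B.∧-cong (fg≈id x) (fg≈id y)))))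
    ; ¬-hom = λ x → f-injective (B.trans (fg≈id _) (B.sym (B.trans (F.¬-hom _) (B.¬-cong (fg≈id x)))))
    ; ⊤-hom = f-injective (B.trans (fg≈id _) (B.sym F.⊤-hom))
    ; ⊥-hom = f-injective (B.trans (fg≈id _) (B.sym F.⊥-hom))
    }
    where module F = IsHom f-hom

  IsHom-monotone : ∀ {f} → IsHom A B f → ∀ {x y} → BooleanOrder._≤_ A x y → BooleanOrder._≤_ B (f x) (f y)
  IsHom-monotone f-hom x≤y = B.trans (IsHom.cong f-hom x≤y) (IsHom.∧-hom f-hom _ _)

IsHom-id : ∀ {A : BooleanAlgebra 0ℓ 0ℓ} → IsHom A A id
IsHom-id {A} = record
  { cong = id ; ∨-hom = λ _ _ → A.refl ; ∧-hom = λ _ _ → A.refl ; ¬-hom = λ _ → A.refl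
  ; ⊤-hom = A.refl ; ⊥-hom = A.refl }
  where module A = BooleanAlgebra A

IsHom-∘ : ∀ {A B C : BooleanAlgebra 0ℓ 0ℓ} {f g} → IsHom A B f → IsHom B C g → IsHom A C (g ∘ f)
IsHom-∘ {C = C} f-hom g-hom = record
  { cong  = G.cong ∘ F.cong
  ; ∨-hom = λ x y → trans (G.cong (F.∨-hom x y)) (G.∨-hom _ _)
  ; ∧-hom = λ x y → trans (G.cong (F.∧-hom x y)) (G.∧-hom _ _)
  ; ¬-hom = λ x → trans (G.cong (F.¬-hom x)) (G.¬-hom _)
  ; ⊤-hom = trans (G.cong F.⊤-hom) G.⊤-hom
  ; ⊥-hom = trans (G.cong F.⊥-hom) G.⊥-hom
  }
  where module F = IsHom f-hom
        module G = IsHom g-hom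
        open BooleanAlgebra C using (trans)

record BooleanPreorder : Set₁ where
  infix  4 _≲_
  infixr 6 _∨_
  infixr 7 _∧_
  field
    Carrier : Set
    _≲_     : Carrier → Carrier → Set
    _∨_ _∧_ : Carrier → Carrier → Carrier
    ¬_      : Carrier → Carrier
    ⊤ ⊥     : Carrier
    ≲-refl  : ∀ {x} → x ≲ x
    ≲-trans : ∀ {x y z} → x ≲ y → y ≲ z → x ≲ z
    x≲x∨y   : ∀ x y → x ≲ x ∨ y
    y≲x∨y   : ∀ x y → y ≲ x ∨ y
    ∨-least : ∀ {x y z} → x ≲ z → y ≲ z → x ∨ y ≲ z
    x∧y≲x   : ∀ x y → x ∧ y ≲ x
    x∧y≲y   : ∀ x y → x ∧ y ≲ y
    ∧-greatest : ∀ {x y z} → z ≲ x → z ≲ y → z ≲ x ∧ y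
    ∧-distribˡ-∨-≲ : ∀ x y z → x ∧ (y ∨ z) ≲ (x ∧ y) ∨ (x ∧ z)
    ⊤≲x∨¬x  : ∀ x → ⊤ ≲ x ∨ ¬ x
    x∧¬x≲⊥  : ∀ x → x ∧ ¬ x ≲ ⊥
    x≲⊤     : ∀ x → x ≲ ⊤
    ⊥≲x     : ∀ x → ⊥ ≲ x

  _≈_ : Carrier → Carrier → Set
  x ≈ y = (x ≲ y) × (y ≲ x)

  private
    orderLattice : Order.IsLattice _≈_ _≲_ _∨_ _∧_
    orderLattice = record
      { isPartialOrder = record
        { isPreorder = record
          { isEquivalence = record
            { refl  = ≲-refl , ≲-refl
            ; sym   = λ (x≲y , y≲x) → y≲x , x≲y
            ; trans = λ (x≲y , y≲x) (y≲z , z≲y) → ≲-trans x≲y y≲z , ≲-trans z≲y y≲x }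
          ; reflexive = proj₁
          ; trans = ≲-trans }
        ; antisym = _,_ }
      ; supremum = λ x y → x≲x∨y x y , y≲x∨y x y , λ _ → ∨-least
      ; infimum  = λ x y → x∧y≲x x y , x∧y≲y x y , λ _ → ∧-greatest }

    distributiveLattice : Order.DistributiveLattice 0ℓ 0ℓ 0ℓ
    distributiveLattice = record
      { isDistributiveLattice = record
        { isLattice = orderLattice
        ; ∧-distribˡ-∨ = λ x y z →
            ∧-distribˡ-∨-≲ x y z
          , ∨-least (∧-greatest (x∧y≲x _ _) (≲-trans (x∧y≲y _ _) (x≲x∨y _ _)))
                    (∧-greatest (x∧y≲x _ _) (≲-trans (x∧y≲y _ _) (y≲x∨y _ _))) } }

    open DistributiveProperties distributiveLattice using (∧-distrib-∨; ∨-distrib-∧)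

    ¬-antitone : ∀ {x y} → x ≲ y → ¬ y ≲ ¬ x
    ¬-antitone {x} {y} x≲y =
      ≲-trans (∧-greatest ≲-refl (≲-trans (x≲⊤ _) (⊤≲x∨¬x x)))
        (≲-trans (∧-distribˡ-∨-≲ (¬ y) x (¬ x))
          (∨-least (≲-trans (∧-greatest (≲-trans (x∧y≲y _ _) x≲y) (x∧y≲x _ _)) (≲-trans (x∧¬x≲⊥ y) (⊥≲x _)))
                   (x∧y≲y _ _)))

    ∨-comm-≲ : ∀ x y → x ∨ y ≲ y ∨ x
    ∨-comm-≲ x y = ∨-least (y≲x∨y y x) (x≲x∨y y x)

    ∧-comm-≲ : ∀ x y → x ∧ y ≲ y ∧ x
    ∧-comm-≲ x y = ∧-greatest (x∧y≲y x y) (x∧y≲x x y)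

  booleanAlgebra : BooleanAlgebra 0ℓ 0ℓ
  booleanAlgebra = record
    { Carrier = Carrier ; _≈_ = _≈_ ; _∨_ = _∨_ ; _∧_ = _∧_ ; ¬_ = ¬_ ; ⊤ = ⊤ ; ⊥ = ⊥
    ; isBooleanAlgebra = record
      { isDistributiveLattice = record
        { isLattice   = OrderLatticeProperties.isAlgLattice (record { isLattice = orderLattice })
        ; ∨-distrib-∧ = ∨-distrib-∧
        ; ∧-distrib-∨ = ∧-distrib-∨ }
      ; ∨-complement = (λ x → x≲⊤ _ , ≲-trans (⊤≲x∨¬x x) (∨-comm-≲ _ _)) , (λ x → x≲⊤ _ , ⊤≲x∨¬x x)
      ; ∧-complement = (λ x → ≲-trans (∧-comm-≲ _ _) (x∧¬x≲⊥ x) , ⊥≲x _) , (λ x → x∧¬x≲⊥ x , ⊥≲x _)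
      ; ¬-cong = λ (x≲y , y≲x) → ¬-antitone y≲x , ¬-antitone x≲y } }

module FreePushout {W : Setoid 0ℓ 0ℓ} {k : ℕ} (F : Fin k → OnSub W) where

  infixr 6 _∨ₜ_
  infixr 7 _∧ₜ_
  data Term : Set where
    gen       : (i : Fin k) → Elem (F i) → Term
    _∨ₜ_ _∧ₜ_ : Term → Term → Term
    ¬ₜ_       : Term → Term
    ⊤ₜ ⊥ₜ     : Term

  infix 4 _≈ₜ_
  data _≈ₜ_ : Term → Term → Set where
    refl  : ∀ {t} → t ≈ₜ t
    sym   : ∀ {t s} → t ≈ₜ s → s ≈ₜ t
    trans : ∀ {t s u} → t ≈ₜ s → s ≈ₜ u → t ≈ₜ u
    ∨-cong : ∀ {t t′ s s′} → t ≈ₜ t′ → s ≈ₜ s′ → t ∨ₜ s ≈ₜ t′ ∨ₜ s′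
    ∧-cong : ∀ {t t′ s s′} → t ≈ₜ t′ → s ≈ₜ s′ → t ∧ₜ s ≈ₜ t′ ∧ₜ s′
    ¬-cong : ∀ {t t′} → t ≈ₜ t′ → ¬ₜ t ≈ₜ ¬ₜ t′
    ∨-comm  : ∀ x y → x ∨ₜ y ≈ₜ y ∨ₜ x
    ∨-assoc : ∀ x y z → (x ∨ₜ y) ∨ₜ z ≈ₜ x ∨ₜ (y ∨ₜ z)
    ∧-comm  : ∀ x y → x ∧ₜ y ≈ₜ y ∧ₜ x
    ∧-assoc : ∀ x y z → (x ∧ₜ y) ∧ₜ z ≈ₜ x ∧ₜ (y ∧ₜ z)
    ∨-absorbs-∧ : ∀ x y → x ∨ₜ (x ∧ₜ y) ≈ₜ x
    ∧-absorbs-∨ : ∀ x y → x ∧ₜ (x ∨ₜ y) ≈ₜ x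
    ∨-distribˡ-∧ : ∀ x y z → x ∨ₜ (y ∧ₜ z) ≈ₜ (x ∨ₜ y) ∧ₜ (x ∨ₜ z)
    ∨-distribʳ-∧ : ∀ x y z → (y ∧ₜ z) ∨ₜ x ≈ₜ (y ∨ₜ x) ∧ₜ (z ∨ₜ x)
    ∧-distribˡ-∨ : ∀ x y z → x ∧ₜ (y ∨ₜ z) ≈ₜ (x ∧ₜ y) ∨ₜ (x ∧ₜ z)
    ∧-distribʳ-∨ : ∀ x y z → (y ∨ₜ z) ∧ₜ x ≈ₜ (y ∧ₜ x) ∨ₜ (z ∧ₜ x)
    ∨-complementˡ : ∀ x → (¬ₜ x) ∨ₜ x ≈ₜ ⊤ₜ
    ∨-complementʳ : ∀ x → x ∨ₜ (¬ₜ x) ≈ₜ ⊤ₜ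
    ∧-complementˡ : ∀ x → (¬ₜ x) ∧ₜ x ≈ₜ ⊥ₜ
    ∧-complementʳ : ∀ x → x ∧ₜ (¬ₜ x) ≈ₜ ⊥ₜ
    gen-cong : ∀ i {a b} → OnSub._≈ₑ_ (F i) a b → gen i a ≈ₜ gen i b
    gen-∨ : ∀ i a b → gen i (OnSub._∨_ (F i) a b) ≈ₜ gen i a ∨ₜ gen i b
    gen-∧ : ∀ i a b → gen i (OnSub._∧_ (F i) a b) ≈ₜ gen i a ∧ₜ gen i b
    gen-¬ : ∀ i a → gen i (OnSub.¬_ (F i) a) ≈ₜ ¬ₜ gen i a
    gen-⊤ : ∀ i → gen i (OnSub.top (F i)) ≈ₜ ⊤ₜ
    gen-⊥ : ∀ i → gen i (OnSub.bot (F i)) ≈ₜ ⊥ₜ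
    gen-glue : ∀ i j x (p : mem (F i) x) (q : mem (F j) x) → gen i (x , p) ≈ₜ gen j (x , q)

  booleanAlgebra : BooleanAlgebra 0ℓ 0ℓ
  booleanAlgebra = record
    { Carrier = Term ; _≈_ = _≈ₜ_ ; _∨_ = _∨ₜ_ ; _∧_ = _∧ₜ_ ; ¬_ = ¬ₜ_ ; ⊤ = ⊤ₜ ; ⊥ = ⊥ₜ
    ; isBooleanAlgebra = record
      { isDistributiveLattice = record
        { isLattice = record
          { isEquivalence = record { refl = refl ; sym = sym ; trans = trans }
          ; ∨-comm = ∨-comm ; ∨-assoc = ∨-assoc ; ∨-cong = ∨-cong
          ; ∧-comm = ∧-comm ; ∧-assoc = ∧-assoc ; ∧-cong = ∧-cong
          ; absorptive = ∨-absorbs-∧ , ∧-absorbs-∨ }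
        ; ∨-distrib-∧ = ∨-distribˡ-∧ , ∨-distribʳ-∧
        ; ∧-distrib-∨ = ∧-distribˡ-∨ , ∧-distribʳ-∨ }
      ; ∨-complement = ∨-complementˡ , ∨-complementʳ
      ; ∧-complement = ∧-complementˡ , ∧-complementʳ
      ; ¬-cong = ¬-cong } }

  module _ (C : BooleanAlgebra 0ℓ 0ℓ) where
    private module C = BooleanAlgebra C

    eval : ((i : Fin k) → Elem (F i) → C.Carrier) → Term → C.Carrier
    eval f (gen i a) = f i a
    eval f (t ∨ₜ s)  = eval f t C.∨ eval f s
    eval f (t ∧ₜ s)  = eval f t C.∧ eval f s
    eval f (¬ₜ t)    = C.¬ eval f t
    eval f ⊤ₜ        = C.⊤
    eval f ⊥ₜ        = C.⊥

    eval-cong : ∀ {f} → IsCocone F C f → ∀ {t s} → t ≈ₜ s → eval f t C.≈ eval f s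
    eval-cong cocone refl = C.refl
    eval-cong cocone (sym e) = C.sym (eval-cong cocone e)
    eval-cong cocone (trans e e′) = C.trans (eval-cong cocone e) (eval-cong cocone e′)
    eval-cong cocone (∨-cong e e′) = C.∨-cong (eval-cong cocone e) (eval-cong cocone e′)
    eval-cong cocone (∧-cong e e′) = C.∧-cong (eval-cong cocone e) (eval-cong cocone e′)
    eval-cong cocone (¬-cong e) = C.¬-cong (eval-cong cocone e)
    eval-cong cocone (∨-comm _ _) = C.∨-comm _ _
    eval-cong cocone (∨-assoc _ _ _) = C.∨-assoc _ _ _
    eval-cong cocone (∧-comm _ _) = C.∧-comm _ _
    eval-cong cocone (∧-assoc _ _ _) = C.∧-assoc _ _ _
    eval-cong cocone (∨-absorbs-∧ _ _) = C.∨-absorbs-∧ _ _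
    eval-cong cocone (∧-absorbs-∨ _ _) = C.∧-absorbs-∨ _ _
    eval-cong cocone (∨-distribˡ-∧ _ _ _) = C.∨-distribˡ-∧ _ _ _
    eval-cong cocone (∨-distribʳ-∧ _ _ _) = C.∨-distribʳ-∧ _ _ _
    eval-cong cocone (∧-distribˡ-∨ _ _ _) = C.∧-distribˡ-∨ _ _ _
    eval-cong cocone (∧-distribʳ-∨ _ _ _) = C.∧-distribʳ-∨ _ _ _
    eval-cong cocone (∨-complementˡ _) = C.∨-complementˡ _
    eval-cong cocone (∨-complementʳ _) = C.∨-complementʳ _
    eval-cong cocone (∧-complementˡ _) = C.∧-complementˡ _
    eval-cong cocone (∧-complementʳ _) = C.∧-complementʳ _
    eval-cong cocone (gen-cong i e) = IsHom.cong (proj₁ cocone i) e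
    eval-cong cocone (gen-∨ i a b) = IsHom.∨-hom (proj₁ cocone i) a b
    eval-cong cocone (gen-∧ i a b) = IsHom.∧-hom (proj₁ cocone i) a b
    eval-cong cocone (gen-¬ i a) = IsHom.¬-hom (proj₁ cocone i) a
    eval-cong cocone (gen-⊤ i) = IsHom.⊤-hom (proj₁ cocone i)
    eval-cong cocone (gen-⊥ i) = IsHom.⊥-hom (proj₁ cocone i)
    eval-cong cocone (gen-glue i j x p q) = proj₂ cocone i j x p q

    eval-isHom : ∀ {f} → IsCocone F C f → IsHom booleanAlgebra C (eval f)
    eval-isHom cocone = record
      { cong = eval-cong cocone
      ; ∨-hom = λ _ _ → C.refl ; ∧-hom = λ _ _ → C.refl ; ¬-hom = λ _ → C.refl
      ; ⊤-hom = C.refl ; ⊥-hom = C.refl }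

    eval-∈-Gen : ∀ {f} (S : C.Carrier → Set) → (∀ i a → S (f i a)) → ∀ t → Gen C S (eval f t)
    eval-∈-Gen S f∈S (gen i a) = gen-base (f∈S i a)
    eval-∈-Gen S f∈S (t ∨ₜ s) = gen-∨-in (eval-∈-Gen S f∈S t) (eval-∈-Gen S f∈S s)
    eval-∈-Gen S f∈S (t ∧ₜ s) = gen-∧-in (eval-∈-Gen S f∈S t) (eval-∈-Gen S f∈S s)
    eval-∈-Gen S f∈S (¬ₜ t) = gen-¬-in (eval-∈-Gen S f∈S t)
    eval-∈-Gen S f∈S ⊤ₜ = gen-⊤-in
    eval-∈-Gen S f∈S ⊥ₜ = gen-⊥-in

    homs-agreeing-on-generators : ∀ {h h′ : Term → C.Carrier} →
      IsHom booleanAlgebra C h → IsHom booleanAlgebra C h′ →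
      (∀ i a → h (gen i a) C.≈ h′ (gen i a)) → ∀ t → h t C.≈ h′ t
    homs-agreeing-on-generators {h} {h′} h-hom h′-hom h≈h′ = go
      where
      module H = IsHom h-hom
      module H′ = IsHom h′-hom
      go : ∀ t → h t C.≈ h′ t
      go (gen i a) = h≈h′ i a
      go (t ∨ₜ s) = C.trans (H.∨-hom t s) (C.trans (C.∨-cong (go t) (go s)) (C.sym (H′.∨-hom t s)))
      go (t ∧ₜ s) = C.trans (H.∧-hom t s) (C.trans (C.∧-cong (go t) (go s)) (C.sym (H′.∧-hom t s)))
      go (¬ₜ t) = C.trans (H.¬-hom t) (C.trans (C.¬-cong (go t)) (C.sym (H′.¬-hom t)))
      go ⊤ₜ = C.trans H.⊤-hom (C.sym H′.⊤-hom)
      go ⊥ₜ = C.trans H.⊥-hom (C.sym H′.⊥-hom)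

  cocone : IsCocone F booleanAlgebra gen
  cocone = (λ i → record
             { cong = gen-cong i ; ∨-hom = gen-∨ i ; ∧-hom = gen-∧ i ; ¬-hom = gen-¬ i
             ; ⊤-hom = gen-⊤ i ; ⊥-hom = gen-⊥ i })
         , gen-glue

  isPushout : IsPushout F booleanAlgebra gen
  isPushout = record
    { cocone = cocone
    ; factor = λ C f f-cocone → eval C f , eval-isHom C f-cocone , λ i a → BooleanAlgebra.refl C
    ; unique = λ C f h h′ h-hom h′-hom h-gen h′-gen →
        homs-agreeing-on-generators C h-hom h′-hom
          (λ i a → BooleanAlgebra.trans C (h-gen i a) (BooleanAlgebra.sym C (h′-gen i a)))
    }

-- The amalgamated free product X ⊗_K Y: elements are finite unions of rectangles a ⊗ b, and a
-- rectangle a ⊗ b vanishes iff a ≤ jX c and b ≤ ¬ jY c for some c ∈ K.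
module Amalgam (X Y K : BooleanAlgebra 0ℓ 0ℓ)
  (jX : BooleanAlgebra.Carrier K → BooleanAlgebra.Carrier X)
  (jY : BooleanAlgebra.Carrier K → BooleanAlgebra.Carrier Y)
  (jX-hom : IsHom K X jX) (jY-hom : IsHom K Y jY) where

  private
    module X = BooleanOrder X
    module Y = BooleanOrder Y
    module K = BooleanOrder K
    module jX = IsHom jX-hom
    module jY = IsHom jY-hom

  Rect : Set
  Rect = X.Carrier × Y.Carrier

  infixr 7 _⊓_
  _⊓_ : Rect → Rect → Rect
  (a , b) ⊓ (c , d) = a X.∧ c , b Y.∧ d

  infix 4 _≼_
  _≼_ : Rect → Rect → Set
  (a , b) ≼ (c , d) = (a X.≤ c) × (b Y.≤ d)

  ⊤ᵣ : Rect
  ⊤ᵣ = X.⊤ , Y.⊤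

  ≼-refl : ∀ {p} → p ≼ p
  ≼-refl = X.≤-refl , Y.≤-refl

  ≼-trans : ∀ {p q r} → p ≼ q → q ≼ r → p ≼ r
  ≼-trans (a , b) (c , d) = X.≤-trans a c , Y.≤-trans b d

  p⊓q≼p : ∀ p q → p ⊓ q ≼ p
  p⊓q≼p _ _ = X.x∧y≤x _ _ , Y.x∧y≤x _ _

  p⊓q≼q : ∀ p q → p ⊓ q ≼ q
  p⊓q≼q _ _ = X.x∧y≤y _ _ , Y.x∧y≤y _ _

  ⊓-greatest : ∀ {p q r} → r ≼ p → r ≼ q → r ≼ p ⊓ q
  ⊓-greatest (a , b) (c , d) = X.∧-greatest a c , Y.∧-greatest b d

  ⊓-monotonic : ∀ {p q r s} → p ≼ q → r ≼ s → p ⊓ r ≼ q ⊓ s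
  ⊓-monotonic (a , b) (c , d) = X.∧-monotonic a c , Y.∧-monotonic b d

  p≼⊤ᵣ : ∀ p → p ≼ ⊤ᵣ
  p≼⊤ᵣ _ = X.x≤⊤ _ , Y.x≤⊤ _

  Disjoint : Rect → Set
  Disjoint (a , b) = Σ[ c ∈ K.Carrier ] (a X.≤ jX c) × (b Y.≤ Y.¬ jY c)

  disjoint-≼ : ∀ {p q} → Disjoint p → q ≼ p → Disjoint q
  disjoint-≼ (c , a≤c , b≤¬c) (a′≤a , b′≤b) = c , X.≤-trans a′≤a a≤c , Y.≤-trans b′≤b b≤¬c

  disjoint-⊥ˡ : ∀ {a b} → a X.≤ X.⊥ → Disjoint (a , b)
  disjoint-⊥ˡ a≤⊥ = K.⊥ , X.≤-trans a≤⊥ (X.⊥≤x _) ,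
    Y.≤-trans (Y.x≤⊤ _) (Y.≤-reflexive (Y.trans (Y.sym Y.¬⊥≈⊤) (Y.¬-cong (Y.sym jY.⊥-hom))))

  disjoint-⊥ʳ : ∀ {a b} → b Y.≤ Y.⊥ → Disjoint (a , b)
  disjoint-⊥ʳ b≤⊥ = K.⊤ , X.≤-trans (X.x≤⊤ _) (X.≤-reflexive (X.sym jX.⊤-hom)) , Y.≤-trans b≤⊥ (Y.⊥≤x _)

  disjoint-∨ˡ : ∀ {a a′ b} → Disjoint (a , b) → Disjoint (a′ , b) → Disjoint (a X.∨ a′ , b)
  disjoint-∨ˡ (c , a≤c , b≤¬c) (c′ , a′≤c′ , b≤¬c′) =
    c K.∨ c′ ,
    X.≤-trans (X.∨-monotonic a≤c a′≤c′) (X.≤-reflexive (X.sym (jX.∨-hom c c′))) ,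
    Y.≤-trans (Y.∧-greatest b≤¬c b≤¬c′)
      (Y.≤-reflexive (Y.trans (Y.sym (Y.deMorgan₂ _ _)) (Y.¬-cong (Y.sym (jY.∨-hom c c′)))))

  disjoint-∨ʳ : ∀ {a b b′} → Disjoint (a , b) → Disjoint (a , b′) → Disjoint (a , b Y.∨ b′)
  disjoint-∨ʳ (c , a≤c , b≤¬c) (c′ , a≤c′ , b′≤¬c′) =
    c K.∧ c′ ,
    X.≤-trans (X.∧-greatest a≤c a≤c′) (X.≤-reflexive (X.sym (jX.∧-hom c c′))) ,
    Y.≤-trans (Y.∨-monotonic b≤¬c b′≤¬c′)
      (Y.≤-reflexive (Y.trans (Y.sym (Y.deMorgan₁ _ _)) (Y.¬-cong (Y.sym (jY.∧-hom c c′)))))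

  disjoint-splitˡ : ∀ {a b} x → Disjoint (a X.∧ x , b) → Disjoint (a X.∧ X.¬ x , b) → Disjoint (a , b)
  disjoint-splitˡ {a} x d d′ = disjoint-≼ (disjoint-∨ˡ d d′) (X.x≤[x∧a]∨[x∧¬a] a x , Y.≤-refl)

  disjoint-splitʳ : ∀ {a b} y → Disjoint (a , b Y.∧ y) → Disjoint (a , b Y.∧ Y.¬ y) → Disjoint (a , b)
  disjoint-splitʳ {b = b} y d d′ = disjoint-≼ (disjoint-∨ʳ d d′) (X.≤-refl , Y.x≤[x∧a]∨[x∧¬a] b y)

  Union : Set
  Union = List Rect

  -- ¬ (a ⊗ b ∨ L) = ((¬ a ⊗ ⊤) ∨ (⊤ ⊗ ¬ b)) ∧ ¬ L
  complement : Union → Union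
  complement [] = [ ⊤ᵣ ]
  complement ((a , b) ∷ L) =
    map ((X.¬ a , Y.⊤) ⊓_) (complement L) ++ map ((X.⊤ , Y.¬ b) ⊓_) (complement L)

  meet : Union → Union → Union
  meet = cartesianProductWith _⊓_

  ∈-complement-∷ : ∀ {a b L q} → q ∈ complement ((a , b) ∷ L) →
    (Σ[ q′ ∈ Rect ] q′ ∈ complement L × q ≡ (X.¬ a , Y.⊤) ⊓ q′) ⊎
    (Σ[ q′ ∈ Rect ] q′ ∈ complement L × q ≡ (X.⊤ , Y.¬ b) ⊓ q′)
  ∈-complement-∷ {a} {b} {L} q∈ with ∈-++⁻ (map ((X.¬ a , Y.⊤) ⊓_) (complement L)) q∈
  ... | inj₁ q∈ˡ = inj₁ (∈-map⁻ _ q∈ˡ)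
  ... | inj₂ q∈ʳ = inj₂ (∈-map⁻ _ q∈ʳ)

  -- The complement laws L ∧ ¬ L = ⊥ and L ∨ ¬ L = ⊤, rectangle by rectangle.
  disjoint-complement : ∀ L {p q} → p ∈ L → q ∈ complement L → Disjoint (p ⊓ q)
  disjoint-complement ((a , b) ∷ L) (here refl) q∈ with ∈-complement-∷ {L = L} q∈
  ... | inj₁ (_ , _ , refl) = disjoint-⊥ˡ (X.≤-trans (X.∧-monotonic X.≤-refl (X.x∧y≤x _ _)) (X.x∧¬x≤⊥ a))
  ... | inj₂ (_ , _ , refl) = disjoint-⊥ʳ (Y.≤-trans (Y.∧-monotonic Y.≤-refl (Y.x∧y≤x _ _)) (Y.x∧¬x≤⊥ b))
  disjoint-complement ((a , b) ∷ L) (there p∈) q∈ with ∈-complement-∷ {L = L} q∈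
  ... | inj₁ (_ , q′∈ , refl) = disjoint-≼ (disjoint-complement L p∈ q′∈) (⊓-monotonic ≼-refl (p⊓q≼q _ _))
  ... | inj₂ (_ , q′∈ , refl) = disjoint-≼ (disjoint-complement L p∈ q′∈) (⊓-monotonic ≼-refl (p⊓q≼q _ _))

  disjoint-by-complement : ∀ L p → (∀ {r} → r ∈ L → Disjoint (p ⊓ r)) →
    (∀ {q} → q ∈ complement L → Disjoint (p ⊓ q)) → Disjoint p
  disjoint-by-complement [] p _ disj-∁ = disjoint-≼ (disj-∁ (here refl)) (⊓-greatest ≼-refl (p≼⊤ᵣ p))
  disjoint-by-complement ((a , b) ∷ L) (x , y) disj disj-∁ =
    disjoint-splitˡ a
      (disjoint-splitʳ b (disj (here refl))
        (disjoint-by-complement L (x X.∧ a , y Y.∧ Y.¬ b)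
          (λ r∈ → disjoint-≼ (disj (there r∈)) (⊓-monotonic (X.x∧y≤x _ _ , Y.x∧y≤x _ _) ≼-refl))
          (λ q∈ → disjoint-≼ (disj-∁ (∈-++⁺ʳ _ (∈-map⁺ _ q∈)))
            ( X.∧-greatest (X.≤-trans (X.x∧y≤x _ _) (X.x∧y≤x _ _)) (X.∧-greatest (X.x≤⊤ _) (X.x∧y≤y _ _))
            , Y.∧-greatest (Y.≤-trans (Y.x∧y≤x _ _) (Y.x∧y≤x _ _)) (Y.∧-monotonic (Y.x∧y≤y _ _) Y.≤-refl)))))
      (disjoint-by-complement L (x X.∧ X.¬ a , y)
        (λ r∈ → disjoint-≼ (disj (there r∈)) (⊓-monotonic (X.x∧y≤x _ _ , Y.≤-refl) ≼-refl))
        (λ q∈ → disjoint-≼ (disj-∁ (∈-++⁺ˡ (∈-map⁺ _ q∈)))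
          ( X.∧-greatest (X.≤-trans (X.x∧y≤x _ _) (X.x∧y≤x _ _)) (X.∧-monotonic (X.x∧y≤y _ _) X.≤-refl)
          , Y.∧-greatest (Y.x∧y≤x _ _) (Y.∧-greatest (Y.x≤⊤ _) (Y.x∧y≤y _ _)))))

  -- p ≤ M in the amalgamated product iff p ∧ ¬ M vanishes.
  infix 4 _⊑_ _≲_
  record _⊑_ (p : Rect) (M : Union) : Set where
    constructor below
    field disjoint-from-complement : ∀ {q} → q ∈ complement M → Disjoint (p ⊓ q)
  open _⊑_

  _≲_ : Union → Union → Set
  L ≲ M = ∀ {p} → p ∈ L → p ⊑ M

  ⊑-≼ : ∀ {p p′ M} → p ⊑ M → p′ ≼ p → p′ ⊑ M
  ⊑-≼ p⊑M p′≼p = below λ q∈ → disjoint-≼ (disjoint-from-complement p⊑M q∈) (⊓-monotonic p′≼p ≼-refl)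

  ∈⇒⊑ : ∀ {p M} → p ∈ M → p ⊑ M
  ∈⇒⊑ {M = M} p∈ = below (disjoint-complement M p∈)

  ⊆⇒≲ : ∀ {L M} → (∀ {p} → p ∈ L → p ∈ M) → L ≲ M
  ⊆⇒≲ L⊆M p∈ = ∈⇒⊑ (L⊆M p∈)

  ⊑-≲ : ∀ {p M N} → p ⊑ M → M ≲ N → p ⊑ N
  ⊑-≲ {p} {M} p⊑M M≲N = below λ {q} q∈ →
    disjoint-by-complement M (p ⊓ q)
      (λ r∈ → disjoint-≼ (disjoint-from-complement (M≲N r∈) q∈) (⊓-greatest (p⊓q≼q _ _) (≼-trans (p⊓q≼p _ _) (p⊓q≼q _ _))))
      (λ q′∈ → disjoint-≼ (disjoint-from-complement p⊑M q′∈) (⊓-monotonic (p⊓q≼p _ _) ≼-refl))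

  ≲-trans : ∀ {L M N} → L ≲ M → M ≲ N → L ≲ N
  ≲-trans L≲M M≲N p∈ = ⊑-≲ (L≲M p∈) M≲N

  meet-greatest : ∀ {L M N} → N ≲ L → N ≲ M → N ≲ meet L M
  meet-greatest {L} {M} N≲L N≲M {p} p∈ = below λ {q} q∈ →
    disjoint-by-complement L (p ⊓ q)
      (λ r∈ → disjoint-by-complement M ((p ⊓ q) ⊓ _)
        (λ s∈ → disjoint-≼ (disjoint-complement (meet L M) (∈-cartesianProductWith⁺ _⊓_ r∈ s∈) q∈)
                  (⊓-greatest (⊓-monotonic (p⊓q≼q _ _) ≼-refl) (≼-trans (p⊓q≼p _ _) (≼-trans (p⊓q≼p _ _) (p⊓q≼q _ _)))))
        (λ s′∈ → disjoint-≼ (disjoint-from-complement (N≲M p∈) s′∈) (⊓-monotonic (≼-trans (p⊓q≼p _ _) (p⊓q≼p _ _)) ≼-refl)))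
      (λ r′∈ → disjoint-≼ (disjoint-from-complement (N≲L p∈) r′∈) (⊓-monotonic (p⊓q≼p _ _) ≼-refl))

  meet≲ˡ : ∀ L M → meet L M ≲ L
  meet≲ˡ L M p∈ with ∈-cartesianProductWith⁻ _⊓_ L M p∈
  ... | _ , _ , r∈ , _ , refl = ⊑-≼ (∈⇒⊑ r∈) (p⊓q≼p _ _)

  meet≲ʳ : ∀ L M → meet L M ≲ M
  meet≲ʳ L M p∈ with ∈-cartesianProductWith⁻ _⊓_ L M p∈
  ... | _ , _ , _ , s∈ , refl = ⊑-≼ (∈⇒⊑ s∈) (p⊓q≼q _ _)

  ++-least : ∀ {L M N} → L ≲ N → M ≲ N → L ++ M ≲ N
  ++-least {L} L≲N M≲N p∈ with ∈-++⁻ L p∈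
  ... | inj₁ p∈L = L≲N p∈L
  ... | inj₂ p∈M = M≲N p∈M

  ≼-into-⊓ : ∀ {r q′ q₁ q₂} → q′ ≼ q₁ ⊓ q₂ → r ⊓ q′ ≼ (r ⊓ q₁) ⊓ q₂
  ≼-into-⊓ q′≼ = ⊓-greatest (⊓-greatest (p⊓q≼p _ _) (≼-trans (p⊓q≼q _ _) (≼-trans q′≼ (p⊓q≼p _ _))))
                            (≼-trans (p⊓q≼q _ _) (≼-trans q′≼ (p⊓q≼q _ _)))

  complement-++ : ∀ L M {q} → q ∈ complement (L ++ M) →
    Σ[ q₁ ∈ Rect ] Σ[ q₂ ∈ Rect ] q₁ ∈ complement L × q₂ ∈ complement M × q ≼ q₁ ⊓ q₂
  complement-++ [] M {q} q∈ = ⊤ᵣ , q , here refl , q∈ , ⊓-greatest (p≼⊤ᵣ q) ≼-refl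
  complement-++ ((a , b) ∷ L) M q∈ with ∈-complement-∷ {L = L ++ M} q∈
  ... | inj₁ (q′ , q′∈ , refl) =
    let q₁ , q₂ , q₁∈ , q₂∈ , q′≼ = complement-++ L M q′∈
    in _ , q₂ , ∈-++⁺ˡ (∈-map⁺ _ q₁∈) , q₂∈ , ≼-into-⊓ q′≼
  ... | inj₂ (q′ , q′∈ , refl) =
    let q₁ , q₂ , q₁∈ , q₂∈ , q′≼ = complement-++ L M q′∈
    in _ , q₂ , ∈-++⁺ʳ _ (∈-map⁺ _ q₁∈) , q₂∈ , ≼-into-⊓ q′≼

  ⊤≲L++complement : ∀ L → [ ⊤ᵣ ] ≲ L ++ complement L
  ⊤≲L++complement L (here refl) = below λ {q} q∈ →
    let q₁ , q₂ , q₁∈ , q₂∈ , q≼ = complement-++ L (complement L) q∈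
    in disjoint-by-complement L (⊤ᵣ ⊓ q)
         (λ r∈ → disjoint-≼ (disjoint-complement L r∈ q₁∈)
                   (⊓-greatest (p⊓q≼q _ _) (≼-trans (p⊓q≼p _ _) (≼-trans (p⊓q≼q _ _) (≼-trans q≼ (p⊓q≼p _ _))))))
         (λ r′∈ → disjoint-≼ (disjoint-complement (complement L) r′∈ q₂∈)
                   (⊓-greatest (p⊓q≼q _ _) (≼-trans (p⊓q≼p _ _) (≼-trans (p⊓q≼q _ _) (≼-trans q≼ (p⊓q≼q _ _))))))

  meet-complement≲[] : ∀ L → meet L (complement L) ≲ []
  meet-complement≲[] L p∈ with ∈-cartesianProductWith⁻ _⊓_ L (complement L) p∈
  ... | _ , _ , r∈ , q∈ , refl = below λ { (here refl) → disjoint-≼ (disjoint-complement L r∈ q∈) (p⊓q≼p _ _) }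

  meet-distribˡ-++ : ∀ L M N → meet L (M ++ N) ≲ meet L M ++ meet L N
  meet-distribˡ-++ L M N = ⊆⇒≲ λ p∈ → distribute p∈
    where
    distribute : ∀ {p} → p ∈ meet L (M ++ N) → p ∈ meet L M ++ meet L N
    distribute p∈ with ∈-cartesianProductWith⁻ _⊓_ L (M ++ N) p∈
    ... | _ , _ , r∈ , s∈ , refl with ∈-++⁻ M s∈
    ...   | inj₁ s∈M = ∈-++⁺ˡ (∈-cartesianProductWith⁺ _⊓_ r∈ s∈M)
    ...   | inj₂ s∈N = ∈-++⁺ʳ (meet L M) (∈-cartesianProductWith⁺ _⊓_ r∈ s∈N)

  booleanPreorder : BooleanPreorder
  booleanPreorder = record
    { Carrier = Union ; _≲_ = _≲_ ; _∨_ = _++_ ; _∧_ = meet ; ¬_ = complement ; ⊤ = [ ⊤ᵣ ] ; ⊥ = []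
    ; ≲-refl = ∈⇒⊑
    ; ≲-trans = λ {L} {M} {N} → ≲-trans {L} {M} {N}
    ; x≲x∨y = λ L M → ⊆⇒≲ ∈-++⁺ˡ
    ; y≲x∨y = λ L M → ⊆⇒≲ (∈-++⁺ʳ L)
    ; ∨-least = λ {L} {M} {N} → ++-least {L} {M} {N}
    ; x∧y≲x = meet≲ˡ
    ; x∧y≲y = meet≲ʳ
    ; ∧-greatest = λ {L} {M} {N} → meet-greatest {L} {M} {N}
    ; ∧-distribˡ-∨-≲ = meet-distribˡ-++
    ; ⊤≲x∨¬x = ⊤≲L++complement
    ; x∧¬x≲⊥ = meet-complement≲[]
    ; x≲⊤ = λ L p∈ → ⊑-≼ (∈⇒⊑ (here refl)) (p≼⊤ᵣ _)
    ; ⊥≲x = λ L () }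

  booleanAlgebra : BooleanAlgebra 0ℓ 0ℓ
  booleanAlgebra = BooleanPreorder.booleanAlgebra booleanPreorder

  private module 𝔸 = BooleanAlgebra booleanAlgebra

  inl : X.Carrier → Union
  inl a = [ (a , Y.⊤) ]

  inr : Y.Carrier → Union
  inr b = [ (X.⊤ , b) ]

  singleton≲ : ∀ {p M} → p ⊑ M → [ p ] ≲ M
  singleton≲ p⊑M (here refl) = p⊑M

  pair≲ : ∀ {p q M} → p ⊑ M → q ⊑ M → p ∷ q ∷ [] ≲ M
  pair≲ p⊑M q⊑M (here refl) = p⊑M
  pair≲ p⊑M q⊑M (there (here refl)) = q⊑M

  ≼⇒≲ : ∀ {p q} → p ≼ q → [ p ] ≲ [ q ]
  ≼⇒≲ p≼q = singleton≲ (⊑-≼ (∈⇒⊑ (here refl)) p≼q)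

  ⊑-⊥ˡ : ∀ {a b M} → a X.≤ X.⊥ → (a , b) ⊑ M
  ⊑-⊥ˡ a≤⊥ = below λ _ → disjoint-⊥ˡ (X.≤-trans (X.x∧y≤x _ _) a≤⊥)

  ⊑-⊥ʳ : ∀ {a b M} → b Y.≤ Y.⊥ → (a , b) ⊑ M
  ⊑-⊥ʳ b≤⊥ = below λ _ → disjoint-⊥ʳ (Y.≤-trans (Y.x∧y≤x _ _) b≤⊥)

  ⊑-∨ˡ : ∀ {a a′ b M} → (a , b) ⊑ M → (a′ , b) ⊑ M → (a X.∨ a′ , b) ⊑ M
  ⊑-∨ˡ ⊑M ⊑M′ = below λ q∈ →
    disjoint-≼ (disjoint-∨ˡ (disjoint-from-complement ⊑M q∈) (disjoint-from-complement ⊑M′ q∈))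
               (X.≤-reflexive (X.∧-distribʳ-∨ _ _ _) , Y.≤-refl)

  ⊑-∨ʳ : ∀ {a b b′ M} → (a , b) ⊑ M → (a , b′) ⊑ M → (a , b Y.∨ b′) ⊑ M
  ⊑-∨ʳ ⊑M ⊑M′ = below λ q∈ →
    disjoint-≼ (disjoint-∨ʳ (disjoint-from-complement ⊑M q∈) (disjoint-from-complement ⊑M′ q∈))
               (X.≤-refl , Y.≤-reflexive (Y.∧-distribʳ-∨ _ _ _))

  inl-isHom : IsHom X booleanAlgebra inl
  inl-isHom = record
    { cong  = λ a≈a′ → ≼⇒≲ (X.≤-reflexive a≈a′ , Y.≤-refl) , ≼⇒≲ (X.≤-reflexive (X.sym a≈a′) , Y.≤-refl)
    ; ∨-hom = λ a a′ →
        singleton≲ (⊑-∨ˡ (∈⇒⊑ (here refl)) (∈⇒⊑ (there (here refl))))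
      , pair≲ (⊑-≼ (∈⇒⊑ (here refl)) (X.x≤x∨y _ _ , Y.≤-refl)) (⊑-≼ (∈⇒⊑ (here refl)) (X.y≤x∨y _ _ , Y.≤-refl))
    ; ∧-hom = λ a a′ → ≼⇒≲ (X.≤-refl , Y.∧-greatest Y.≤-refl Y.≤-refl) , ≼⇒≲ (X.≤-refl , Y.x≤⊤ _)
    ; ¬-hom = λ a →
        singleton≲ (⊑-≼ (∈⇒⊑ (here refl)) (X.∧-greatest X.≤-refl (X.x≤⊤ _) , Y.∧-greatest Y.≤-refl Y.≤-refl))
      , pair≲ (⊑-≼ (∈⇒⊑ (here refl)) (X.x∧y≤x _ _ , Y.x≤⊤ _)) (⊑-⊥ʳ (Y.≤-trans (Y.x∧y≤x _ _) (Y.≤-reflexive Y.¬⊤≈⊥)))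
    ; ⊤-hom = ∈⇒⊑ , ∈⇒⊑
    ; ⊥-hom = singleton≲ (⊑-⊥ˡ X.≤-refl) , λ ()
    }

  inr-isHom : IsHom Y booleanAlgebra inr
  inr-isHom = record
    { cong  = λ b≈b′ → ≼⇒≲ (X.≤-refl , Y.≤-reflexive b≈b′) , ≼⇒≲ (X.≤-refl , Y.≤-reflexive (Y.sym b≈b′))
    ; ∨-hom = λ b b′ →
        singleton≲ (⊑-∨ʳ (∈⇒⊑ (here refl)) (∈⇒⊑ (there (here refl))))
      , pair≲ (⊑-≼ (∈⇒⊑ (here refl)) (X.≤-refl , Y.x≤x∨y _ _)) (⊑-≼ (∈⇒⊑ (here refl)) (X.≤-refl , Y.y≤x∨y _ _))
    ; ∧-hom = λ b b′ → ≼⇒≲ (X.∧-greatest X.≤-refl X.≤-refl , Y.≤-refl) , ≼⇒≲ (X.x≤⊤ _ , Y.≤-refl)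
    ; ¬-hom = λ b →
        singleton≲ (⊑-≼ (∈⇒⊑ (there (here refl))) (X.∧-greatest X.≤-refl X.≤-refl , Y.∧-greatest Y.≤-refl (Y.x≤⊤ _)))
      , pair≲ (⊑-⊥ˡ (X.≤-trans (X.x∧y≤x _ _) (X.≤-reflexive X.¬⊤≈⊥))) (⊑-≼ (∈⇒⊑ (here refl)) (X.x≤⊤ _ , Y.x∧y≤x _ _))
    ; ⊤-hom = ∈⇒⊑ , ∈⇒⊑
    ; ⊥-hom = singleton≲ (⊑-⊥ʳ Y.≤-refl) , λ ()
    }

  inl∘jX≈inr∘jY : ∀ c → inl (jX c) 𝔸.≈ inr (jY c)
  inl∘jX≈inr∘jY c =
      singleton≲ (below λ { (here refl) → disjoint-⊥ˡ (X.≤-trans (X.x∧y≤y _ _) (X.≤-trans (X.x∧y≤x _ _) (X.≤-reflexive X.¬⊤≈⊥)))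
                 ; (there (here refl)) → c , X.x∧y≤x _ _ , Y.≤-trans (Y.x∧y≤y _ _) (Y.x∧y≤x _ _) })
    , singleton≲ (below λ { (here refl) →
                     K.¬ c
                   , X.≤-trans (X.x∧y≤y _ _) (X.≤-trans (X.x∧y≤x _ _) (X.≤-reflexive (X.sym (jX.¬-hom c))))
                   , Y.≤-trans (Y.x∧y≤x _ _) (Y.≤-reflexive (Y.trans (Y.sym (Y.¬-involutive _)) (Y.¬-cong (Y.sym (jY.¬-hom c)))))
                 ; (there (here refl)) → disjoint-⊥ʳ (Y.≤-trans (Y.x∧y≤y _ _) (Y.≤-trans (Y.x∧y≤x _ _) (Y.≤-reflexive Y.¬⊤≈⊥))) })

  module _ (C : BooleanAlgebra 0ℓ 0ℓ) where
    private module C = BooleanOrder C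

    homs-agreeing-on-inl-inr : ∀ {h h′ : Union → C.Carrier} → IsHom booleanAlgebra C h → IsHom booleanAlgebra C h′ →
      (∀ a → h (inl a) C.≈ h′ (inl a)) → (∀ b → h (inr b) C.≈ h′ (inr b)) → ∀ L → h L C.≈ h′ L
    homs-agreeing-on-inl-inr {h} {h′} h-hom h′-hom h≈h′ˡ h≈h′ʳ = go
      where
      module H = IsHom h-hom
      module H′ = IsHom h′-hom
      rect≈inl∧inr : ∀ a b → [ (a , b) ] 𝔸.≈ meet (inl a) (inr b)
      rect≈inl∧inr a b = ≼⇒≲ (X.∧-greatest X.≤-refl (X.x≤⊤ _) , Y.∧-greatest (Y.x≤⊤ _) Y.≤-refl)
                       , ≼⇒≲ (X.x∧y≤x _ _ , Y.x∧y≤y _ _)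
      on-rect : ∀ {k : Union → C.Carrier} → IsHom booleanAlgebra C k → ∀ a b → k [ (a , b) ] C.≈ k (inl a) C.∧ k (inr b)
      on-rect k-hom a b = C.trans (IsHom.cong k-hom (rect≈inl∧inr a b)) (IsHom.∧-hom k-hom (inl a) (inr b))
      go : ∀ L → h L C.≈ h′ L
      go [] = C.trans H.⊥-hom (C.sym H′.⊥-hom)
      go ((a , b) ∷ L) =
        C.trans (H.∨-hom [ (a , b) ] L)
          (C.trans (C.∨-cong (C.trans (on-rect h-hom a b) (C.trans (C.∧-cong (h≈h′ˡ a) (h≈h′ʳ b)) (C.sym (on-rect h′-hom a b))))
                             (go L))
                   (C.sym (H′.∨-hom [ (a , b) ] L)))

    module Factorisation {f : X.Carrier → C.Carrier} {g : Y.Carrier → C.Carrier}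
      (f-hom : IsHom X C f) (g-hom : IsHom Y C g) (f∘jX≈g∘jY : ∀ c → f (jX c) C.≈ g (jY c)) where
      private
        module F = IsHom f-hom
        module G = IsHom g-hom
      open SetoidReasoning C.setoid

      rect : Rect → C.Carrier
      rect (a , b) = f a C.∧ g b

      fold : Union → C.Carrier
      fold [] = C.⊥
      fold (p ∷ L) = rect p C.∨ fold L

      fold-++ : ∀ L M → fold (L ++ M) C.≈ fold L C.∨ fold M
      fold-++ [] M = C.sym (C.∨-identityˡ _)
      fold-++ (p ∷ L) M = C.trans (C.∨-congˡ (fold-++ L M)) (C.sym (C.∨-assoc _ _ _))

      rect-⊓ : ∀ p q → rect (p ⊓ q) C.≈ rect p C.∧ rect q
      rect-⊓ (a , b) (c , d) = C.trans (C.∧-cong (F.∧-hom a c) (G.∧-hom b d)) (C.∧-interchange _ _ _ _)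

      fold-map-⊓ : ∀ p N → fold (map (p ⊓_) N) C.≈ rect p C.∧ fold N
      fold-map-⊓ p [] = C.sym (C.∧-zeroʳ _)
      fold-map-⊓ p (q ∷ N) = C.trans (C.∨-cong (rect-⊓ p q) (fold-map-⊓ p N)) (C.sym (C.∧-distribˡ-∨ _ _ _))

      fold-meet : ∀ L M → fold (meet L M) C.≈ fold L C.∧ fold M
      fold-meet [] M = C.sym (C.∧-zeroˡ _)
      fold-meet (p ∷ L) M =
        C.trans (fold-++ (map (p ⊓_) M) (meet L M))
          (C.trans (C.∨-cong (fold-map-⊓ p M) (fold-meet L M)) (C.sym (C.∧-distribʳ-∨ _ _ _)))

      fold-complement : ∀ L → fold (complement L) C.≈ C.¬ fold L
      fold-complement [] = begin
        (f X.⊤ C.∧ g Y.⊤) C.∨ C.⊥ ≈⟨ C.∨-identityʳ _ ⟩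
        f X.⊤ C.∧ g Y.⊤           ≈⟨ C.∧-cong F.⊤-hom G.⊤-hom ⟩
        C.⊤ C.∧ C.⊤               ≈⟨ C.∧-idem C.⊤ ⟩
        C.⊤                       ≈⟨ C.¬⊥≈⊤ ⟨
        C.¬ C.⊥                   ∎
      fold-complement ((a , b) ∷ L) = begin
        fold (map ((X.¬ a , Y.⊤) ⊓_) (complement L) ++ map ((X.⊤ , Y.¬ b) ⊓_) (complement L))
          ≈⟨ fold-++ (map _ (complement L)) (map _ (complement L)) ⟩
        fold (map ((X.¬ a , Y.⊤) ⊓_) (complement L)) C.∨ fold (map ((X.⊤ , Y.¬ b) ⊓_) (complement L))
          ≈⟨ C.∨-cong (fold-map-⊓ _ (complement L)) (fold-map-⊓ _ (complement L)) ⟩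
        (rect (X.¬ a , Y.⊤) C.∧ fold (complement L)) C.∨ (rect (X.⊤ , Y.¬ b) C.∧ fold (complement L))
          ≈⟨ C.∧-distribʳ-∨ _ _ _ ⟨
        (rect (X.¬ a , Y.⊤) C.∨ rect (X.⊤ , Y.¬ b)) C.∧ fold (complement L)
          ≈⟨ C.∧-cong (C.∨-cong (C.trans (C.∧-cong (F.¬-hom a) G.⊤-hom) (C.∧-identityʳ _))
                                (C.trans (C.∧-cong F.⊤-hom (G.¬-hom b)) (C.∧-identityˡ _)))
                      (fold-complement L) ⟩
        (C.¬ f a C.∨ C.¬ g b) C.∧ C.¬ fold L
          ≈⟨ C.∧-congʳ (C.deMorgan₁ _ _) ⟨
        C.¬ (f a C.∧ g b) C.∧ C.¬ fold L
          ≈⟨ C.deMorgan₂ _ _ ⟨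
        C.¬ (rect (a , b) C.∨ fold L) ∎

      rect-disjoint : ∀ {p} → Disjoint p → rect p C.≤ C.⊥
      rect-disjoint (c , a≤jXc , b≤¬jYc) =
        C.≤-trans (C.∧-monotonic (IsHom-monotone f-hom a≤jXc) (IsHom-monotone g-hom b≤¬jYc))
          (C.≤-trans (C.∧-monotonic (C.≤-reflexive (f∘jX≈g∘jY c)) (C.≤-reflexive (G.¬-hom (jY c)))) (C.x∧¬x≤⊥ _))

      fold-disjoint : ∀ N → (∀ {r} → r ∈ N → Disjoint r) → fold N C.≤ C.⊥
      fold-disjoint [] _ = C.≤-refl
      fold-disjoint (r ∷ N) disj = C.∨-least (rect-disjoint (disj (here refl))) (fold-disjoint N (disj ∘ there))

      rect-⊑ : ∀ {p M} → p ⊑ M → rect p C.≤ fold M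
      rect-⊑ {p} {M} p⊑M = C.x∧¬y≤⊥⇒x≤y (C.≤-trans
        (C.≤-reflexive (C.trans (C.∧-congˡ (C.sym (fold-complement M))) (C.sym (fold-map-⊓ p (complement M)))))
        (fold-disjoint (map (p ⊓_) (complement M)) disjoint))
        where
        disjoint : ∀ {r} → r ∈ map (p ⊓_) (complement M) → Disjoint r
        disjoint r∈ with ∈-map⁻ (p ⊓_) r∈
        ... | _ , q∈ , refl = disjoint-from-complement p⊑M q∈

      fold-≲ : ∀ L M → L ≲ M → fold L C.≤ fold M
      fold-≲ [] M _ = C.⊥≤x _
      fold-≲ (p ∷ L) M L≲M = C.∨-least (rect-⊑ (L≲M (here refl))) (fold-≲ L M (L≲M ∘ there))

      fold-isHom : IsHom booleanAlgebra C fold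
      fold-isHom = record
        { cong  = λ {L} {M} (L≲M , M≲L) → C.≤-antisym (fold-≲ L M L≲M) (fold-≲ M L M≲L)
        ; ∨-hom = fold-++
        ; ∧-hom = fold-meet
        ; ¬-hom = fold-complement
        ; ⊤-hom = C.trans (fold-complement []) C.¬⊥≈⊤
        ; ⊥-hom = C.refl
        }

      fold∘inl : ∀ a → fold (inl a) C.≈ f a
      fold∘inl a = C.trans (C.∨-identityʳ _) (C.trans (C.∧-congˡ G.⊤-hom) (C.∧-identityʳ _))

      fold∘inr : ∀ b → fold (inr b) C.≈ g b
      fold∘inr b = C.trans (C.∨-identityʳ _) (C.trans (C.∧-congʳ F.⊤-hom) (C.∧-identityˡ _))

  inl≲inr⇒interpolant : ∀ {a b} → inl a ≲ inr b → Σ[ c ∈ K.Carrier ] (a X.≤ jX c) × (jY c Y.≤ b)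
  inl≲inr⇒interpolant {a} {b} a≲b
    with disjoint-from-complement (a≲b (here refl)) (there (here refl))
  ... | c , a≤jXc , ¬b≤¬jYc =
    c , X.≤-trans (X.∧-greatest X.≤-refl (X.∧-greatest (X.x≤⊤ _) (X.x≤⊤ _))) a≤jXc
      , Y.¬-reflects-≤ (Y.≤-trans (Y.∧-greatest (Y.x≤⊤ _) (Y.∧-greatest Y.≤-refl (Y.x≤⊤ _))) ¬b≤¬jYc)

  inr≲inl⇒interpolant : ∀ {a b} → inr b ≲ inl a → Σ[ c ∈ K.Carrier ] (b Y.≤ jY c) × (jX c X.≤ a)
  inr≲inl⇒interpolant {a} {b} b≲a
    with disjoint-from-complement (b≲a (here refl)) (here refl)
  ... | c , ¬a≤jXc , b≤¬jYc =
    K.¬ c , Y.≤-trans (Y.∧-greatest Y.≤-refl (Y.∧-greatest (Y.x≤⊤ _) (Y.x≤⊤ _)))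
                      (Y.≤-trans b≤¬jYc (Y.≤-reflexive (Y.sym (jY.¬-hom c))))
          , X.≤-trans (X.≤-reflexive (jX.¬-hom c))
                      (X.¬x≤y⇒¬y≤x (X.≤-trans (X.∧-greatest (X.x≤⊤ _) (X.∧-greatest X.≤-refl (X.x≤⊤ _))) ¬a≤jXc))

  module Injective (jX-injective : ∀ {c c′} → jX c X.≈ jX c′ → c K.≈ c′)
                   (jY-injective : ∀ {c c′} → jY c Y.≈ jY c′ → c K.≈ c′) where

    jX-reflects-≤ : ∀ {c c′} → jX c X.≤ jX c′ → c K.≤ c′
    jX-reflects-≤ {c} {c′} jXc≤jXc′ = jX-injective (X.trans jXc≤jXc′ (X.sym (jX.∧-hom c c′)))

    jY-reflects-≤ : ∀ {c c′} → jY c Y.≤ jY c′ → c K.≤ c′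
    jY-reflects-≤ {c} {c′} jYc≤jYc′ = jY-injective (Y.trans jYc≤jYc′ (Y.sym (jY.∧-hom c c′)))

    inl-reflects-≤ : ∀ {a a′} → inl a ≲ inl a′ → a X.≤ a′
    inl-reflects-≤ a≲a′ with disjoint-from-complement (a≲a′ (here refl)) (here refl)
    ... | c , a∧¬a′≤jXc , ⊤≤¬jYc =
      let jYc≤⊥ = Y.≤-trans (Y.≤-reflexive (Y.sym (Y.¬-involutive _)))
                    (Y.≤-trans (Y.¬-antitone (Y.≤-trans (Y.∧-greatest Y.≤-refl (Y.∧-greatest Y.≤-refl Y.≤-refl)) ⊤≤¬jYc))
                               (Y.≤-reflexive Y.¬⊤≈⊥))
          c≤⊥ = jY-reflects-≤ (Y.≤-trans jYc≤⊥ (Y.≤-reflexive (Y.sym jY.⊥-hom)))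
      in X.x∧¬y≤⊥⇒x≤y (X.≤-trans (X.∧-monotonic X.≤-refl (X.∧-greatest X.≤-refl (X.x≤⊤ _)))
                        (X.≤-trans a∧¬a′≤jXc (X.≤-trans (IsHom-monotone jX-hom c≤⊥) (X.≤-reflexive jX.⊥-hom))))

    inr-reflects-≤ : ∀ {b b′} → inr b ≲ inr b′ → b Y.≤ b′
    inr-reflects-≤ b≲b′ with disjoint-from-complement (b≲b′ (here refl)) (there (here refl))
    ... | c , ⊤≤jXc , b∧¬b′≤¬jYc =
      let ⊤≤c = jX-reflects-≤ (X.≤-trans (X.≤-reflexive jX.⊤-hom)
                  (X.≤-trans (X.∧-greatest X.≤-refl (X.∧-greatest X.≤-refl X.≤-refl)) ⊤≤jXc))
          ¬jYc≤⊥ = Y.≤-trans (Y.¬-antitone (Y.≤-trans (Y.≤-reflexive (Y.sym jY.⊤-hom)) (IsHom-monotone jY-hom ⊤≤c)))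
                             (Y.≤-reflexive Y.¬⊤≈⊥)
      in Y.x∧¬y≤⊥⇒x≤y (Y.≤-trans (Y.∧-monotonic Y.≤-refl (Y.∧-greatest Y.≤-refl (Y.x≤⊤ _)))
                        (Y.≤-trans b∧¬b′≤¬jYc ¬jYc≤⊥))

    inl-injective : ∀ {a a′} → inl a 𝔸.≈ inl a′ → a X.≈ a′
    inl-injective (a≲a′ , a′≲a) = X.≤-antisym (inl-reflects-≤ a≲a′) (inl-reflects-≤ a′≲a)

    inr-injective : ∀ {b b′} → inr b 𝔸.≈ inr b′ → b Y.≈ b′
    inr-injective (b≲b′ , b′≲b) = Y.≤-antisym (inr-reflects-≤ b≲b′) (inr-reflects-≤ b′≲b)

    inl≈inr⇒common : ∀ {a b} → inl a 𝔸.≈ inr b → Σ[ c ∈ K.Carrier ] (a X.≈ jX c) × (b Y.≈ jY c)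
    inl≈inr⇒common (a≲b , b≲a) with inl≲inr⇒interpolant a≲b | inr≲inl⇒interpolant b≲a
    ... | c , a≤jXc , jYc≤b | c′ , b≤jYc′ , jXc′≤a =
      let c≤c′ = jY-reflects-≤ (Y.≤-trans jYc≤b b≤jYc′)
          c′≤c = jX-reflects-≤ (X.≤-trans jXc′≤a a≤jXc)
      in c , X.≤-antisym a≤jXc (X.≤-trans (IsHom-monotone jX-hom c≤c′) jXc′≤a)
           , Y.≤-antisym (Y.≤-trans b≤jYc′ (IsHom-monotone jY-hom c′≤c)) jYc≤b

subalgebra-inclusions-cocone : ∀ (D : BooleanAlgebra 0ℓ 0ℓ) {k} (C : Fin k → BooleanAlgebra.Carrier D → Set)
  (sub : ∀ i → IsSubalgebra D (C i)) → IsCocone (λ i → subOnSub D (C i) (sub i)) D (λ i → proj₁)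
subalgebra-inclusions-cocone D C sub =
    (λ i → record { cong = id ; ∨-hom = λ _ _ → D.refl ; ∧-hom = λ _ _ → D.refl ; ¬-hom = λ _ → D.refl
                  ; ⊤-hom = D.refl ; ⊥-hom = D.refl })
  , λ _ _ _ _ _ → D.refl
  where module D = BooleanAlgebra D

record InjectivePushout {U : Setoid 0ℓ 0ℓ} {m : ℕ} (H : Fin m → OnSub U) : Set₁ where
  field
    P : BooleanAlgebra 0ℓ 0ℓ
    ι : (i : Fin m) → Elem (H i) → BooleanAlgebra.Carrier P
    isPushout : IsPushout H P ι
    ι-injective : ∀ i j x y (p : mem (H i) x) (q : mem (H j) y) →
                  BooleanAlgebra._≈_ P (ι i (x , p)) (ι j (y , q)) → Setoid._≈_ U x y

  ι-isHom : ∀ i → IsHom (toBA (H i)) P (ι i)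
  ι-isHom = proj₁ (IsPushout.cocone isPushout)

  ι-glue : ∀ i j x (p : mem (H i) x) (q : mem (H j) x) → BooleanAlgebra._≈_ P (ι i (x , p)) (ι j (x , q))
  ι-glue = proj₂ (IsPushout.cocone isPushout)

emptyPushout : ∀ {U : Setoid 0ℓ 0ℓ} (H : Fin 0 → OnSub U) → InjectivePushout H
emptyPushout H = record
  { P = Bool.∨-∧-booleanAlgebra
  ; ι = λ ()
  ; isPushout = record
    { cocone = (λ ()) , (λ ())
    ; factor = λ C _ _ → constants C , constants-isHom C , λ ()
    ; unique = λ C _ h h′ h-hom h′-hom _ _ → λ
        { true  → BooleanAlgebra.trans C (IsHom.⊤-hom h-hom) (BooleanAlgebra.sym C (IsHom.⊤-hom h′-hom))
        ; false → BooleanAlgebra.trans C (IsHom.⊥-hom h-hom) (BooleanAlgebra.sym C (IsHom.⊥-hom h′-hom)) }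
    }
  ; ι-injective = λ ()
  }
  where
  constants : (C : BooleanAlgebra 0ℓ 0ℓ) → Bool → BooleanAlgebra.Carrier C
  constants C b = if b then BooleanAlgebra.⊤ C else BooleanAlgebra.⊥ C

  constants-isHom : (C : BooleanAlgebra 0ℓ 0ℓ) → IsHom Bool.∨-∧-booleanAlgebra C (constants C)
  constants-isHom C = record
    { cong  = λ { refl → C.refl }
    ; ∨-hom = λ { true _ → C.sym (C.∨-zeroˡ _) ; false _ → C.sym (C.∨-identityˡ _) }
    ; ∧-hom = λ { true _ → C.sym (C.∧-identityˡ _) ; false _ → C.sym (C.∧-zeroˡ _) }
    ; ¬-hom = λ { true → C.sym C.¬⊤≈⊥ ; false → C.sym C.¬⊥≈⊤ }
    ; ⊤-hom = C.refl
    ; ⊥-hom = C.refl }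
    where module C where
            open BooleanAlgebra C public
            open BooleanAlgebraProperties C public

module _ {U : Setoid 0ℓ 0ℓ} where
  transport : {Z Z′ : OnSub U} → Z ≡ Z′ → Elem Z → Elem Z′
  transport Z≡Z′ (x , x∈Z) = x , subst (λ W → mem W x) Z≡Z′ x∈Z

  transport-isHom : {Z Z′ : OnSub U} (Z≡Z′ : Z ≡ Z′) → IsHom (toBA Z) (toBA Z′) (transport Z≡Z′)
  transport-isHom refl = IsHom-id

record Extension {U : Setoid 0ℓ 0ℓ} {m : ℕ} {G : Fin m → OnSub U} {F : Fin (suc m) → OnSub U}
                 (S : InjectivePushout G) : Set₁ where
  private module S = InjectivePushout S
  field
    next : InjectivePushout F
  private module S′ = InjectivePushout next
  field
    embed : BooleanAlgebra.Carrier S.P → BooleanAlgebra.Carrier S′.P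
    embed-isHom : IsHom S.P S′.P embed
    embed-injective : ∀ {s s′} → BooleanAlgebra._≈_ S′.P (embed s) (embed s′) → BooleanAlgebra._≈_ S.P s s′
    embed-ι : ∀ j x (p : mem (G j) x) (q : mem (F (inject₁ j)) x) →
              BooleanAlgebra._≈_ S′.P (S′.ι (inject₁ j) (x , q)) (embed (S.ι j (x , p)))

module Extend {U : Setoid 0ℓ 0ℓ} {m : ℕ} {G : Fin m → OnSub U} {X : OnSub U} {F : Fin (suc m) → OnSub U}
  (F-old : ∀ j → F (inject₁ j) ≡ G j) (F-new : F (fromℕ m) ≡ X)
  (overlaps : ∀ i → Overlap (G i) X)
  (S : InjectivePushout G)
  (reflects : CommReflects G (mem X))
  (commutes : Commute (toBA X) (λ i a → mem (G i) (proj₁ a))) where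

  open InjectivePushout S
  private
    module U = Setoid U
    module P = BooleanAlgebra P
    module X = BooleanAlgebra (toBA X)
    module G i = OnSub (G i)
    module Overlapᵢ i = Overlap (overlaps i)

  T : Fin m → P.Carrier → Set
  T i = Img (G i) P (ι i) (mem X)

  T-commute : Commute P T
  T-commute = proj₁ (proj₂ reflects P ι isPushout)

  T-reflects : ∀ i z → Img (G i) P (ι i) (λ _ → Unit) z → Gen P (λ w → Σ[ j ∈ Fin m ] T j w) z → T i z
  T-reflects i z z∈ι[G] z∈⟨T⟩ = proj₁ (proj₂ (proj₂ reflects P ι isPushout) i z) (z∈ι[G] , z∈⟨T⟩)

  ι[G∩X] : Fin m → OnSub P.setoid
  ι[G∩X] i = subOnSub P (T i) (proj₁ T-commute i)

  G∩X : Fin m → OnSub X.setoid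
  G∩X i = subOnSub (toBA X) (λ a → mem (G i) (proj₁ a)) (proj₁ commutes i)

  module Q = FreePushout ι[G∩X]
  module R = FreePushout G∩X

  ρ : ∀ i → Elem (G∩X i) → Elem (ι[G∩X] i)
  ρ i ((x , x∈X) , x∈G) = ι i (x , x∈G) , x , x∈G , x∈X , P.refl

  ρ⁻¹ : ∀ i → Elem (ι[G∩X] i) → Elem (G∩X i)
  ρ⁻¹ i (_ , x , x∈G , x∈X , _) = (x , x∈X) , x∈G

  ρ-isHom : ∀ i → IsHom (toBA (G∩X i)) (toBA (ι[G∩X] i)) (ρ i)
  ρ-isHom i = record
    { cong  = ιᵢ.cong
    ; ∨-hom = λ ((x , x∈X) , x∈G) ((y , y∈X) , y∈G) →
        P.trans (ιᵢ.cong (U.sym (Overlapᵢ.∨-agree i x y x∈G x∈X y∈G y∈X))) (ιᵢ.∨-hom _ _)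
    ; ∧-hom = λ ((x , x∈X) , x∈G) ((y , y∈X) , y∈G) →
        P.trans (ιᵢ.cong (U.sym (Overlapᵢ.∧-agree i x y x∈G x∈X y∈G y∈X))) (ιᵢ.∧-hom _ _)
    ; ¬-hom = λ ((x , x∈X) , x∈G) → P.trans (ιᵢ.cong (U.sym (Overlapᵢ.¬-agree i x x∈G x∈X))) (ιᵢ.¬-hom _)
    ; ⊤-hom = P.trans (ιᵢ.cong (U.sym (Overlapᵢ.top-agree i))) ιᵢ.⊤-hom
    ; ⊥-hom = P.trans (ιᵢ.cong (U.sym (Overlapᵢ.bot-agree i))) ιᵢ.⊥-hom
    }
    where module ιᵢ = IsHom (ι-isHom i)

  ρ⁻¹-isHom : ∀ i → IsHom (toBA (ι[G∩X] i)) (toBA (G∩X i)) (ρ⁻¹ i)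
  ρ⁻¹-isHom i = IsHom-inverse (ρ-isHom i) (λ (_ , _ , _ , _ , ιx≈z) → ιx≈z)
                              (ι-injective i i _ _ _ _)

  φ-cocone : IsCocone ι[G∩X] R.booleanAlgebra (λ i → R.gen i ∘ ρ⁻¹ i)
  φ-cocone = (λ i → IsHom-∘ (ρ⁻¹-isHom i) (proj₁ R.cocone i))
           , λ i j z (x , x∈Gᵢ , x∈X , ιᵢx≈z) (y , y∈Gⱼ , y∈X , ιⱼy≈z) →
               let x≈y = ι-injective i j x y x∈Gᵢ y∈Gⱼ (P.trans ιᵢx≈z (P.sym ιⱼy≈z))
               in R.trans (R.gen-cong i x≈y) (R.gen-glue i j (y , y∈X) (G.mem-resp i x≈y x∈Gᵢ) y∈Gⱼ)

  ψ-cocone : IsCocone G∩X Q.booleanAlgebra (λ i → Q.gen i ∘ ρ i)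
  ψ-cocone = (λ i → IsHom-∘ (ρ-isHom i) (proj₁ Q.cocone i))
           , λ i j (x , x∈X) x∈Gᵢ x∈Gⱼ →
               let ιᵢx≈ιⱼx = ι-glue i j x x∈Gᵢ x∈Gⱼ
               in Q.trans (Q.gen-cong i ιᵢx≈ιⱼx)
                          (Q.gen-glue i j _ (x , x∈Gᵢ , x∈X , ιᵢx≈ιⱼx) (x , x∈Gⱼ , x∈X , P.refl))

  φ : Q.Term → R.Term
  φ = Q.eval R.booleanAlgebra (λ i → R.gen i ∘ ρ⁻¹ i)

  φ-isHom : IsHom Q.booleanAlgebra R.booleanAlgebra φ
  φ-isHom = Q.eval-isHom R.booleanAlgebra φ-cocone

  ψ : R.Term → Q.Term
  ψ = R.eval Q.booleanAlgebra (λ i → Q.gen i ∘ ρ i)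

  ψ∘φ≈id : ∀ t → ψ (φ t) Q.≈ₜ t
  ψ∘φ≈id = Q.homs-agreeing-on-generators Q.booleanAlgebra
             (IsHom-∘ φ-isHom (R.eval-isHom Q.booleanAlgebra ψ-cocone)) IsHom-id
             (λ i (_ , _ , _ , _ , ιx≈z) → Q.gen-cong i ιx≈z)

  K→P : Q.Term → P.Carrier
  K→P = Q.eval P (λ i → proj₁)

  K→P-isHom : IsHom Q.booleanAlgebra P K→P
  K→P-isHom = Q.eval-isHom P (subalgebra-inclusions-cocone P T (proj₁ T-commute))

  K→P-injective : ∀ {t t′} → K→P t P.≈ K→P t′ → t Q.≈ₜ t′
  K→P-injective = proj₂ T-commute Q.booleanAlgebra Q.gen Q.isPushout K→P K→P-isHom (λ _ _ → P.refl) _ _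

  R→X : R.Term → Elem X
  R→X = R.eval (toBA X) (λ i → proj₁)

  R→X-isHom : IsHom R.booleanAlgebra (toBA X) R→X
  R→X-isHom = R.eval-isHom (toBA X) (subalgebra-inclusions-cocone (toBA X) _ (proj₁ commutes))

  R→X-injective : ∀ {t t′} → R→X t X.≈ R→X t′ → t R.≈ₜ t′
  R→X-injective = proj₂ commutes R.booleanAlgebra R.gen R.isPushout R→X R→X-isHom (λ _ _ → U.refl) _ _

  K→X : Q.Term → Elem X
  K→X = R→X ∘ φ

  K→X-isHom : IsHom Q.booleanAlgebra (toBA X) K→X
  K→X-isHom = IsHom-∘ φ-isHom R→X-isHom

  K→X-injective : ∀ {t t′} → K→X t X.≈ K→X t′ → t Q.≈ₜ t′
  K→X-injective {t} {t′} φt≈φt′ =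
    Q.trans (Q.sym (ψ∘φ≈id t))
      (Q.trans (IsHom.cong (R.eval-isHom Q.booleanAlgebra ψ-cocone) (R→X-injective {φ t} {φ t′} φt≈φt′)) (ψ∘φ≈id t′))

  module 𝔸 = Amalgam P (toBA X) Q.booleanAlgebra K→P K→X K→P-isHom K→X-isHom
  module 𝔸-injective = 𝔸.Injective K→P-injective K→X-injective
  private module P′ = BooleanAlgebra 𝔸.booleanAlgebra

  -- By (a)(3) a point of ιᵢ[Aᵢ] lying in K already lies in ιᵢ[Aᵢ ∩ X]; then use that K embeds into X.
  inl≈inr⇒≈ : ∀ i x (p : mem (G i) x) y (q : mem X y) → 𝔸.inl (ι i (x , p)) P′.≈ 𝔸.inr (y , q) → x U.≈ y
  inl≈inr⇒≈ i x p y q inl≈inr =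
    let c , ιx≈c , y≈c = 𝔸-injective.inl≈inr⇒common inl≈inr
        c∈⟨T⟩ = Q.eval-∈-Gen P (λ z → Σ[ j ∈ Fin m ] T j z) (λ j a → j , proj₂ a) c
        x′ , p′ , x′∈X , ιx′≈ιx = T-reflects i (ι i (x , p)) (x , p , tt , P.refl) (gen-resp (P.sym ιx≈c) c∈⟨T⟩)
        k = Q.gen i (ι i (x , p) , x′ , p′ , x′∈X , ιx′≈ιx)
    in U.trans (U.sym (ι-injective i i x′ x p′ p ιx′≈ιx))
               (U.sym (U.trans y≈c (X.sym {K→X k} {K→X c} (IsHom.cong K→X-isHom {k} {c} (K→P-injective {k} {c} ιx≈c)))))

  ι′ᵥ : ∀ {i} → View i → Elem (F i) → 𝔸.Union
  ι′ᵥ ‵fromℕ       a = 𝔸.inr (transport F-new a)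
  ι′ᵥ (‵inject₁ j) a = 𝔸.inl (ι j (transport (F-old j) a))

  ι′ : ∀ i → Elem (F i) → 𝔸.Union
  ι′ i = ι′ᵥ (view i)

  ι′-inject₁ : ∀ j x (p : mem (G j) x) (q : mem (F (inject₁ j)) x) → ι′ (inject₁ j) (x , q) P′.≈ 𝔸.inl (ι j (x , p))
  ι′-inject₁ j x p q rewrite view-inject₁ j = IsHom.cong 𝔸.inl-isHom (IsHom.cong (ι-isHom j) U.refl)

  ι′-fromℕ : ∀ x (p : mem X x) (q : mem (F (fromℕ m)) x) → ι′ (fromℕ m) (x , q) P′.≈ 𝔸.inr (x , p)
  ι′-fromℕ x p q rewrite view-fromℕ m = IsHom.cong 𝔸.inr-isHom U.refl

  ι′ᵥ-isHom : ∀ {i} (v : View i) → IsHom (toBA (F i)) 𝔸.booleanAlgebra (ι′ᵥ v)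
  ι′ᵥ-isHom ‵fromℕ       = IsHom-∘ (transport-isHom F-new) 𝔸.inr-isHom
  ι′ᵥ-isHom (‵inject₁ j) = IsHom-∘ (transport-isHom (F-old j)) (IsHom-∘ (ι-isHom j) 𝔸.inl-isHom)

  inl-ι≈inr : ∀ j x (p : mem (G j) x) (q : mem X x) → 𝔸.inl (ι j (x , p)) P′.≈ 𝔸.inr (x , q)
  inl-ι≈inr j x p q = 𝔸.inl∘jX≈inr∘jY (Q.gen j (ι j (x , p) , x , p , q , P.refl))

  ι′ᵥ-glue : ∀ {i j} (v : View i) (w : View j) x p q → ι′ᵥ v (x , p) P′.≈ ι′ᵥ w (x , q)
  ι′ᵥ-glue ‵fromℕ ‵fromℕ x p q = IsHom.cong 𝔸.inr-isHom U.refl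
  ι′ᵥ-glue ‵fromℕ (‵inject₁ j) x p q = P′.sym (inl-ι≈inr j x _ _)
  ι′ᵥ-glue (‵inject₁ i) ‵fromℕ x p q = inl-ι≈inr i x _ _
  ι′ᵥ-glue (‵inject₁ i) (‵inject₁ j) x p q = IsHom.cong 𝔸.inl-isHom (ι-glue i j x _ _)

  ι′ᵥ-injective : ∀ {i j} (v : View i) (w : View j) x y p q → ι′ᵥ v (x , p) P′.≈ ι′ᵥ w (y , q) → x U.≈ y
  ι′ᵥ-injective ‵fromℕ ‵fromℕ x y p q e = 𝔸-injective.inr-injective e
  ι′ᵥ-injective ‵fromℕ (‵inject₁ j) x y p q e = U.sym (inl≈inr⇒≈ j y _ x _ (P′.sym e))
  ι′ᵥ-injective (‵inject₁ i) ‵fromℕ x y p q e = inl≈inr⇒≈ i x _ y _ e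
  ι′ᵥ-injective (‵inject₁ i) (‵inject₁ j) x y p q e = ι-injective i j x y _ _ (𝔸-injective.inl-injective e)

  ι′-cocone : IsCocone F 𝔸.booleanAlgebra ι′
  ι′-cocone = (λ i → ι′ᵥ-isHom (view i)) , λ i j → ι′ᵥ-glue (view i) (view j)

  module _ (C : BooleanAlgebra 0ℓ 0ℓ) {f : (i : Fin (suc m)) → Elem (F i) → BooleanAlgebra.Carrier C} where
    private module C = BooleanAlgebra C

    f-old : (j : Fin m) → Elem (G j) → C.Carrier
    f-old j = f (inject₁ j) ∘ transport (≡.sym (F-old j))

    f-new : Elem X → C.Carrier
    f-new = f (fromℕ m) ∘ transport (≡.sym F-new)

    on-old : ∀ {k} → IsHom 𝔸.booleanAlgebra C k → (∀ i a → k (ι′ i a) C.≈ f i a) →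
             ∀ j a → k (𝔸.inl (ι j a)) C.≈ f-old j a
    on-old k-hom k∘ι′≈f j (x , p) = C.trans (IsHom.cong k-hom (P′.sym (ι′-inject₁ j x p _))) (k∘ι′≈f (inject₁ j) _)

    on-new : ∀ {k} → IsHom 𝔸.booleanAlgebra C k → (∀ i a → k (ι′ i a) C.≈ f i a) →
             ∀ b → k (𝔸.inr b) C.≈ f-new b
    on-new k-hom k∘ι′≈f (y , q) = C.trans (IsHom.cong k-hom (P′.sym (ι′-fromℕ y q _))) (k∘ι′≈f (fromℕ m) _)

    unique : ∀ {h h′} → IsHom 𝔸.booleanAlgebra C h → IsHom 𝔸.booleanAlgebra C h′ →
             (∀ i a → h (ι′ i a) C.≈ f i a) → (∀ i a → h′ (ι′ i a) C.≈ f i a) → ∀ y → h y C.≈ h′ y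
    unique h-hom h′-hom h∘ι′≈f h′∘ι′≈f =
      𝔸.homs-agreeing-on-inl-inr C h-hom h′-hom
        (IsPushout.unique isPushout C f-old _ _ (IsHom-∘ 𝔸.inl-isHom h-hom) (IsHom-∘ 𝔸.inl-isHom h′-hom)
           (on-old h-hom h∘ι′≈f) (on-old h′-hom h′∘ι′≈f))
        (λ b → C.trans (on-new h-hom h∘ι′≈f b) (C.sym (on-new h′-hom h′∘ι′≈f b)))

    module _ (f-cocone : IsCocone F C f) where
      f-old-cocone : IsCocone G C f-old
      f-old-cocone = (λ j → IsHom-∘ (transport-isHom (≡.sym (F-old j))) (proj₁ f-cocone (inject₁ j)))
                   , λ i j x _ _ → proj₂ f-cocone (inject₁ i) (inject₁ j) x _ _

      f-new-isHom : IsHom (toBA X) C f-new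
      f-new-isHom = IsHom-∘ (transport-isHom (≡.sym F-new)) (proj₁ f-cocone (fromℕ m))

      MediatingMap : Set
      MediatingMap = Σ[ h ∈ (𝔸.Union → C.Carrier) ] IsHom 𝔸.booleanAlgebra C h × (∀ i a → h (ι′ i a) C.≈ f i a)

      factor : MediatingMap
      factor = through (IsPushout.factor isPushout C f-old f-old-cocone)
        where
        through : Σ[ g ∈ (P.Carrier → C.Carrier) ] IsHom P C g × (∀ j a → g (ι j a) C.≈ f-old j a) → MediatingMap
        through (g , g-isHom , g∘ι≈f-old) = Fold.fold , Fold.fold-isHom , λ i → fold∘ι′ᵥ (view i)
          where
          g∘K→P≈f-new∘K→X : ∀ c → g (K→P c) C.≈ f-new (K→X c)
          g∘K→P≈f-new∘K→X = Q.homs-agreeing-on-generators C (IsHom-∘ K→P-isHom g-isHom) (IsHom-∘ K→X-isHom f-new-isHom)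
            λ i (_ , x , p , _ , ιx≈z) →
              C.trans (IsHom.cong g-isHom (P.sym ιx≈z)) (C.trans (g∘ι≈f-old i (x , p)) (proj₂ f-cocone (inject₁ i) (fromℕ m) x _ _))
          module Fold = 𝔸.Factorisation C g-isHom f-new-isHom g∘K→P≈f-new∘K→X
          fold∘ι′ᵥ : ∀ {i} (v : View i) a → Fold.fold (ι′ᵥ v a) C.≈ f i a
          fold∘ι′ᵥ ‵fromℕ (x , _) = C.trans (Fold.fold∘inr _) (proj₂ f-cocone (fromℕ m) (fromℕ m) x _ _)
          fold∘ι′ᵥ (‵inject₁ j) (x , _) =
            C.trans (Fold.fold∘inl _) (C.trans (g∘ι≈f-old j _) (proj₂ f-cocone (inject₁ j) (inject₁ j) x _ _))

  extension : Extension {F = F} S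
  extension = record
    { next = record
      { P = 𝔸.booleanAlgebra
      ; ι = ι′
      ; isPushout = record
        { cocone = ι′-cocone
        ; factor = λ C f → factor C
        ; unique = λ C f h h′ → unique C {f} {h} {h′} }
      ; ι-injective = λ i j → ι′ᵥ-injective (view i) (view j) }
    ; embed = 𝔸.inl
    ; embed-isHom = 𝔸.inl-isHom
    ; embed-injective = 𝔸-injective.inl-injective
    ; embed-ι = λ j x p q → ι′-inject₁ j x p q
    }

IsPushout-iso : ∀ {W : Setoid 0ℓ 0ℓ} {k} {H : Fin k → OnSub W} {B C : BooleanAlgebra 0ℓ 0ℓ}
  {ι : (i : Fin k) → Elem (H i) → BooleanAlgebra.Carrier B} → IsPushout H B ι →
  {θ : BooleanAlgebra.Carrier B → BooleanAlgebra.Carrier C} {θ⁻¹ : BooleanAlgebra.Carrier C → BooleanAlgebra.Carrier B} →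
  IsHom B C θ → IsHom C B θ⁻¹ →
  (∀ b → BooleanAlgebra._≈_ B (θ⁻¹ (θ b)) b) → (∀ c → BooleanAlgebra._≈_ C (θ (θ⁻¹ c)) c) →
  {ι′ : (i : Fin k) → Elem (H i) → BooleanAlgebra.Carrier C} → (∀ i a → BooleanAlgebra._≈_ C (ι′ i a) (θ (ι i a))) →
  IsPushout H C ι′
IsPushout-iso {B = B} {C} pushout {θ} {θ⁻¹} θ-isHom θ⁻¹-isHom θ⁻¹∘θ≈id θ∘θ⁻¹≈id ι′≈θ∘ι = record
  { cocone = (λ i → IsHom-resp (IsHom-∘ (proj₁ (IsPushout.cocone pushout) i) θ-isHom) (ι′≈θ∘ι i))
           , λ i j x p q → C.trans (ι′≈θ∘ι i _)
                             (C.trans (IsHom.cong θ-isHom (proj₂ (IsPushout.cocone pushout) i j x p q)) (C.sym (ι′≈θ∘ι j _)))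
  ; factor = λ D f f-cocone →
      let h , h-isHom , h∘ι≈f = IsPushout.factor pushout D f f-cocone
      in h ∘ θ⁻¹ , IsHom-∘ θ⁻¹-isHom h-isHom ,
         λ i a → BooleanAlgebra.trans D
                   (IsHom.cong h-isHom (B.trans (IsHom.cong θ⁻¹-isHom (ι′≈θ∘ι i a)) (θ⁻¹∘θ≈id _))) (h∘ι≈f i a)
  ; unique = λ D f h h′ h-isHom h′-isHom h∘ι′≈f h′∘ι′≈f c →
      let module D = BooleanAlgebra D
          h∘θ≈h′∘θ = IsPushout.unique pushout D f (h ∘ θ) (h′ ∘ θ) (IsHom-∘ θ-isHom h-isHom) (IsHom-∘ θ-isHom h′-isHom)
                       (λ i a → D.trans (IsHom.cong h-isHom (C.sym (ι′≈θ∘ι i a))) (h∘ι′≈f i a))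
                       (λ i a → D.trans (IsHom.cong h′-isHom (C.sym (ι′≈θ∘ι i a))) (h′∘ι′≈f i a))
      in D.trans (IsHom.cong h-isHom (C.sym (θ∘θ⁻¹≈id c)))
                 (D.trans (h∘θ≈h′∘θ (θ⁻¹ c)) (IsHom.cong h′-isHom (θ∘θ⁻¹≈id c)))
  }
  where module B = BooleanAlgebra B
        module C = BooleanAlgebra C

module Image {V : Setoid 0ℓ 0ℓ} (B : BooleanAlgebra 0ℓ 0ℓ) (e : BooleanAlgebra.Carrier B → Setoid.Carrier V)
  (e-cong : ∀ {b b′} → BooleanAlgebra._≈_ B b b′ → Setoid._≈_ V (e b) (e b′))
  (e-injective : ∀ {b b′} → Setoid._≈_ V (e b) (e b′) → BooleanAlgebra._≈_ B b b′) where
  private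
    module V = Setoid V
    module B = BooleanAlgebra B

  InImage : V.Carrier → Set
  InImage v = Σ[ b ∈ B.Carrier ] v V.≈ e b

  preimage : Σ V.Carrier InImage → B.Carrier
  preimage (_ , b , _) = b

  toImage : B.Carrier → Σ V.Carrier InImage
  toImage b = e b , b , V.refl

  preimage-cong : ∀ {v w : Σ V.Carrier InImage} → proj₁ v V.≈ proj₁ w → preimage v B.≈ preimage w
  preimage-cong {_ , _ , v≈eb} {_ , _ , w≈eb′} v≈w = e-injective (V.trans (V.sym v≈eb) (V.trans v≈w w≈eb′))

  onSub : OnSub V
  onSub = record
    { mem = InImage
    ; mem-resp = λ v≈w (b , v≈eb) → b , V.trans (V.sym v≈w) v≈eb
    ; _∨_ = λ v w → toImage (preimage v B.∨ preimage w)
    ; _∧_ = λ v w → toImage (preimage v B.∧ preimage w)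
    ; ¬_  = λ v → toImage (B.¬ preimage v)
    ; top = toImage B.⊤
    ; bot = toImage B.⊥
    ; isBooleanAlgebra = record
      { isDistributiveLattice = record
        { isLattice = record
          { isEquivalence = record { refl = V.refl ; sym = V.sym ; trans = V.trans }
          ; ∨-comm  = λ _ _ → e-cong (B.∨-comm _ _)
          ; ∨-assoc = λ _ _ _ → e-cong (B.∨-assoc _ _ _)
          ; ∨-cong  = λ {v} {v′} {w} {w′} v≈v′ w≈w′ → e-cong (B.∨-cong (preimage-cong {v} {v′} v≈v′) (preimage-cong {w} {w′} w≈w′))
          ; ∧-comm  = λ _ _ → e-cong (B.∧-comm _ _)
          ; ∧-assoc = λ _ _ _ → e-cong (B.∧-assoc _ _ _)
          ; ∧-cong  = λ {v} {v′} {w} {w′} v≈v′ w≈w′ → e-cong (B.∧-cong (preimage-cong {v} {v′} v≈v′) (preimage-cong {w} {w′} w≈w′))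
          ; absorptive = (λ (_ , _ , v≈eb) _ → V.trans (e-cong (B.∨-absorbs-∧ _ _)) (V.sym v≈eb))
                       , (λ (_ , _ , v≈eb) _ → V.trans (e-cong (B.∧-absorbs-∨ _ _)) (V.sym v≈eb)) }
        ; ∨-distrib-∧ = (λ _ _ _ → e-cong (B.∨-distribˡ-∧ _ _ _)) , (λ _ _ _ → e-cong (B.∨-distribʳ-∧ _ _ _))
        ; ∧-distrib-∨ = (λ _ _ _ → e-cong (B.∧-distribˡ-∨ _ _ _)) , (λ _ _ _ → e-cong (B.∧-distribʳ-∨ _ _ _)) }
      ; ∨-complement = (λ _ → e-cong (B.∨-complementˡ _)) , (λ _ → e-cong (B.∨-complementʳ _))
      ; ∧-complement = (λ _ → e-cong (B.∧-complementˡ _)) , (λ _ → e-cong (B.∧-complementʳ _))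
      ; ¬-cong = λ {v} {w} v≈w → e-cong (B.¬-cong (preimage-cong {v} {w} v≈w)) } }

  toImage-isHom : IsHom B (toBA onSub) toImage
  toImage-isHom = record
    { cong = e-cong ; ∨-hom = λ _ _ → V.refl ; ∧-hom = λ _ _ → V.refl ; ¬-hom = λ _ → V.refl
    ; ⊤-hom = V.refl ; ⊥-hom = V.refl }

  preimage-isHom : IsHom (toBA onSub) B preimage
  preimage-isHom = record
    { cong = λ {v} {w} → preimage-cong {v} {w} ; ∨-hom = λ _ _ → B.refl ; ∧-hom = λ _ _ → B.refl ; ¬-hom = λ _ → B.refl
    ; ⊤-hom = B.refl ; ⊥-hom = B.refl }

  toImage∘preimage≈id : ∀ v → proj₁ (toImage (preimage v)) V.≈ proj₁ v
  toImage∘preimage≈id (_ , _ , v≈eb) = V.sym v≈eb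

SubAlgVia-fromHom : ∀ {U V : Setoid 0ℓ 0ℓ} {f : Setoid.Carrier U → Setoid.Carrier V} {A : OnSub U} {B : OnSub V}
  {h : Elem A → Elem B} → IsHom (toBA A) (toBA B) h → (∀ a → Setoid._≈_ V (proj₁ (h a)) (f (proj₁ a))) →
  SubAlgVia f A B
SubAlgVia-fromHom {V = V} {f} {A} {B} {h} h-isHom h≈f = record
  { incl = λ x x∈A → OnSub.mem-resp B (h≈f (x , x∈A)) (proj₂ (h (x , x∈A)))
  ; ∨-pres = λ a b → V.trans (V.sym (h≈f _)) (V.trans (H.∨-hom a b) (B.∨-cong (h≈f a) (h≈f b)))
  ; ∧-pres = λ a b → V.trans (V.sym (h≈f _)) (V.trans (H.∧-hom a b) (B.∧-cong (h≈f a) (h≈f b)))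
  ; ¬-pres = λ a → V.trans (V.sym (h≈f _)) (V.trans (H.¬-hom a) (B.¬-cong (h≈f a)))
  ; top-pres = V.trans (V.sym (h≈f _)) H.⊤-hom
  ; bot-pres = V.trans (V.sym (h≈f _)) H.⊥-hom
  }
  where module V = Setoid V
        module H = IsHom h-isHom
        module B = BooleanAlgebra (toBA B)

module Tower {U : Setoid 0ℓ 0ℓ} {n : ℕ} {A : Fin n → OnSub U} (overlapping : Overlapping A)
  (hypotheses : ∀ (m : Fin n) →
     CommReflects (restrict A (<⇒≤ (toℕ<n m))) (mem (A m))
     × Commute (toBA (A m)) (λ (i : Fin (toℕ m)) a → mem (restrict A (<⇒≤ (toℕ<n m)) i) (proj₁ a))) where

  private module U = Setoid U

  Hypotheses : OnSub U → (j : ℕ) → .(j ≤ n) → Set₁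
  Hypotheses X j j≤n =
    CommReflects (restrict A j≤n) (mem X) × Commute (toBA X) (λ (i : Fin j) a → mem (restrict A j≤n i) (proj₁ a))

  Hypotheses-reindex : ∀ X {j k} → j ≡ k → .{j≤n : j ≤ n} .{k≤n : k ≤ n} → Hypotheses X j j≤n → Hypotheses X k k≤n
  Hypotheses-reindex X refl h = h

  hypotheses-at : ∀ m .(m<n : m < n) → Hypotheses (A (fromℕ< m<n)) m (<⇒≤ m<n)
  hypotheses-at m m<n = Hypotheses-reindex (A (fromℕ< m<n)) (toℕ-fromℕ< m<n) (hypotheses (fromℕ< m<n))

  A-old : ∀ m .(m<n : m < n) (j : Fin m) → restrict A m<n (inject₁ j) ≡ restrict A (<⇒≤ m<n) j
  A-old m m<n j = cong A (toℕ-injective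
    (≡.trans (toℕ-inject≤ (inject₁ j) m<n) (≡.trans (toℕ-inject₁ j) (≡.sym (toℕ-inject≤ j (<⇒≤ m<n))))))

  A-new : ∀ m .(m<n : m < n) → restrict A m<n (fromℕ m) ≡ A (fromℕ< m<n)
  A-new m m<n = cong A (toℕ-injective
    (≡.trans (toℕ-inject≤ (fromℕ m) m<n) (≡.trans (toℕ-fromℕ m) (≡.sym (toℕ-fromℕ< m<n)))))

  mutual
    stage : ∀ m .(m≤n : m ≤ n) → InjectivePushout (restrict A m≤n)
    stage zero    _   = emptyPushout _
    stage (suc m) m<n = Extension.next (extension m m<n)

    extension : ∀ m .(m<n : m < n) → Extension {F = restrict A m<n} (stage m (<⇒≤ m<n))
    extension m m<n = Extend.extension (A-old m m<n) (A-new m m<n) (λ _ → overlapping _ _) (stage m (<⇒≤ m<n))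
                        (proj₁ (hypotheses-at m m<n)) (proj₂ (hypotheses-at m m<n))

  P : ∀ m → .(m ≤ n) → BooleanAlgebra 0ℓ 0ℓ
  P m m≤n = InjectivePushout.P (stage m m≤n)

  Carrier : ∀ m → .(m ≤ n) → Set
  Carrier m m≤n = BooleanAlgebra.Carrier (P m m≤n)

  ι : ∀ m .(m≤n : m ≤ n) (i : Fin m) → Elem (restrict A m≤n i) → Carrier m m≤n
  ι m m≤n = InjectivePushout.ι (stage m m≤n)

  lift : ∀ {m j} → m ≤′ j → .(m≤n : m ≤ n) .(j≤n : j ≤ n) → Carrier m m≤n → Carrier j j≤n
  lift ≤′-refl             _   _   = id
  lift (≤′-step {j} m≤′j) m≤n j<n = Extension.embed (extension j j<n) ∘ lift m≤′j m≤n (<⇒≤ j<n)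

  lift-isHom : ∀ {m j} (m≤′j : m ≤′ j) .(m≤n : m ≤ n) .(j≤n : j ≤ n) → IsHom (P m m≤n) (P j j≤n) (lift m≤′j m≤n j≤n)
  lift-isHom ≤′-refl             _   _   = IsHom-id
  lift-isHom (≤′-step {j} m≤′j) m≤n j<n =
    IsHom-∘ (lift-isHom m≤′j m≤n (<⇒≤ j<n)) (Extension.embed-isHom (extension j j<n))

  lift-injective : ∀ {m j} (m≤′j : m ≤′ j) .(m≤n : m ≤ n) .(j≤n : j ≤ n) {s s′} →
    BooleanAlgebra._≈_ (P j j≤n) (lift m≤′j m≤n j≤n s) (lift m≤′j m≤n j≤n s′) → BooleanAlgebra._≈_ (P m m≤n) s s′
  lift-injective ≤′-refl             _   _   s≈s′ = s≈s′
  lift-injective (≤′-step {j} m≤′j) m≤n j<n s≈s′ =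
    lift-injective m≤′j m≤n (<⇒≤ j<n) (Extension.embed-injective (extension j j<n) s≈s′)

  lift-ι : ∀ {m j} (m≤′j : m ≤′ j) .(m≤n : m ≤ n) .(j≤n : j ≤ n) (i : Fin m) x (p : mem (restrict A m≤n i) x) →
    Σ[ i′ ∈ Fin j ] Σ[ p′ ∈ mem (restrict A j≤n i′) x ]
      BooleanAlgebra._≈_ (P j j≤n) (lift m≤′j m≤n j≤n (ι m m≤n i (x , p))) (ι j j≤n i′ (x , p′))
  lift-ι ≤′-refl _ j≤n i x p = i , p , BooleanAlgebra.refl (P _ j≤n)
  lift-ι (≤′-step {j} m≤′j) m≤n j<n i x p =
    let i′ , p′ , lift≈ι = lift-ι m≤′j m≤n (<⇒≤ j<n) i x p
        p″ = subst (λ W → mem W x) (≡.sym (A-old j j<n i′)) p′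
        module Pⱼ₊₁ = BooleanAlgebra (P (suc j) j<n)
    in inject₁ i′ , p″ ,
       Pⱼ₊₁.trans (IsHom.cong (Extension.embed-isHom (extension j j<n)) lift≈ι)
                  (Pⱼ₊₁.sym (Extension.embed-ι (extension j j<n) i′ x p′ p″))

  Pₙ : BooleanAlgebra 0ℓ 0ℓ
  Pₙ = P n ℕ.≤-refl

  private module Pₙ = BooleanAlgebra Pₙ
  open InjectivePushout (stage n ℕ.≤-refl) using () renaming (ι to ιₙ; ι-isHom to ιₙ-isHom; ι-glue to ιₙ-glue; ι-injective to ιₙ-injective)

  toTop : ∀ m .(m≤n : m ≤ n) → Carrier m m≤n → Pₙ.Carrier
  toTop m m≤n = lift (ℕ.≤⇒≤′ (recompute (m ≤? n) m≤n)) m≤n ℕ.≤-refl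

  toTop-isHom : ∀ m .(m≤n : m ≤ n) → IsHom (P m m≤n) Pₙ (toTop m m≤n)
  toTop-isHom m m≤n = lift-isHom (ℕ.≤⇒≤′ (recompute (m ≤? n) m≤n)) m≤n ℕ.≤-refl

  toTop-injective : ∀ m .(m≤n : m ≤ n) {s s′} → toTop m m≤n s Pₙ.≈ toTop m m≤n s′ → BooleanAlgebra._≈_ (P m m≤n) s s′
  toTop-injective m m≤n = lift-injective (ℕ.≤⇒≤′ (recompute (m ≤? n) m≤n)) m≤n ℕ.≤-refl

  toTop-ι : ∀ m .(m≤n : m ≤ n) (i : Fin m) x (p : mem (restrict A m≤n i) x) →
    Σ[ i′ ∈ Fin n ] Σ[ p′ ∈ mem (restrict A ℕ.≤-refl i′) x ] toTop m m≤n (ι m m≤n i (x , p)) Pₙ.≈ ιₙ i′ (x , p′)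
  toTop-ι m m≤n = lift-ι (ℕ.≤⇒≤′ (recompute (m ≤? n) m≤n)) m≤n ℕ.≤-refl

  -- Uniqueness out of the pushout: both sides send each ι(x) to some ιₙ(x), and these are glued in Pₙ.
  toTop∘lift≈toTop : ∀ {i j} (i≤′j : i ≤′ j) .(i≤n : i ≤ n) .(j≤n : j ≤ n) s →
    toTop j j≤n (lift i≤′j i≤n j≤n s) Pₙ.≈ toTop i i≤n s
  toTop∘lift≈toTop {i} {j} i≤′j i≤n j≤n =
    IsPushout.unique (InjectivePushout.isPushout (stage i i≤n)) Pₙ (λ k → toTop i i≤n ∘ ι i i≤n k) _ _
      (IsHom-∘ (lift-isHom i≤′j i≤n j≤n) (toTop-isHom j j≤n)) (toTop-isHom i i≤n)
      (λ k (x , p) →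
        let k′ , p′ , lift≈ι = lift-ι i≤′j i≤n j≤n k x p
            k″ , p″ , toTopⱼ≈ιₙ = toTop-ι j j≤n k′ x p′
            k‴ , p‴ , toTopᵢ≈ιₙ = toTop-ι i i≤n k x p
        in Pₙ.trans (IsHom.cong (toTop-isHom j j≤n) lift≈ι)
             (Pₙ.trans toTopⱼ≈ιₙ (Pₙ.trans (ιₙ-glue k″ k‴ x p″ p‴) (Pₙ.sym toTopᵢ≈ιₙ))))
      (λ _ _ → Pₙ.refl)

  infix 4 _⇝_ _≈ᵥ_
  _⇝_ : U.Carrier → Pₙ.Carrier → Set
  x ⇝ t = Σ[ i ∈ Fin n ] Σ[ p ∈ mem (restrict A ℕ.≤-refl i) x ] ιₙ i (x , p) Pₙ.≈ t

  _≈ᵥ_ : U.Carrier ⊎ Pₙ.Carrier → U.Carrier ⊎ Pₙ.Carrier → Set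
  inj₁ x ≈ᵥ inj₁ y = x U.≈ y
  inj₁ x ≈ᵥ inj₂ t = x ⇝ t
  inj₂ t ≈ᵥ inj₁ x = x ⇝ t
  inj₂ s ≈ᵥ inj₂ t = s Pₙ.≈ t

  ≈ᵥ-refl : ∀ {v} → v ≈ᵥ v
  ≈ᵥ-refl {inj₁ _} = U.refl
  ≈ᵥ-refl {inj₂ _} = Pₙ.refl

  ≈ᵥ-sym : ∀ {v w} → v ≈ᵥ w → w ≈ᵥ v
  ≈ᵥ-sym {inj₁ _} {inj₁ _} = U.sym
  ≈ᵥ-sym {inj₁ _} {inj₂ _} = id
  ≈ᵥ-sym {inj₂ _} {inj₁ _} = id
  ≈ᵥ-sym {inj₂ _} {inj₂ _} = Pₙ.sym

  ≈ᵥ-trans : ∀ {u v w} → u ≈ᵥ v → v ≈ᵥ w → u ≈ᵥ w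
  ≈ᵥ-trans {inj₁ _} {inj₁ _} {inj₁ _} x≈y y≈z = U.trans x≈y y≈z
  ≈ᵥ-trans {inj₁ _} {inj₁ _} {inj₂ _} x≈y (i , p , ιy≈t) =
    i , OnSub.mem-resp (restrict A ℕ.≤-refl i) (U.sym x≈y) p , Pₙ.trans (IsHom.cong (ιₙ-isHom i) x≈y) ιy≈t
  ≈ᵥ-trans {inj₁ x} {inj₂ _} {inj₁ y} (i , p , ιx≈t) (j , q , ιy≈t) = ιₙ-injective i j x y p q (Pₙ.trans ιx≈t (Pₙ.sym ιy≈t))
  ≈ᵥ-trans {inj₁ _} {inj₂ _} {inj₂ _} (i , p , ιx≈s) s≈t = i , p , Pₙ.trans ιx≈s s≈t
  ≈ᵥ-trans {inj₂ _} {inj₁ _} {inj₁ _} (i , p , ιx≈t) x≈y =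
    i , OnSub.mem-resp (restrict A ℕ.≤-refl i) x≈y p , Pₙ.trans (IsHom.cong (ιₙ-isHom i) (U.sym x≈y)) ιx≈t
  ≈ᵥ-trans {inj₂ _} {inj₁ x} {inj₂ _} (i , p , ιx≈s) (j , q , ιx≈t) = Pₙ.trans (Pₙ.sym ιx≈s) (Pₙ.trans (ιₙ-glue i j x p q) ιx≈t)
  ≈ᵥ-trans {inj₂ _} {inj₂ _} {inj₁ _} s≈t (i , p , ιx≈t) = i , p , Pₙ.trans ιx≈t (Pₙ.sym s≈t)
  ≈ᵥ-trans {inj₂ _} {inj₂ _} {inj₂ _} s≈t t≈u = Pₙ.trans s≈t t≈u

  V : Setoid 0ℓ 0ℓ
  V = record
    { Carrier = U.Carrier ⊎ Pₙ.Carrier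
    ; _≈_ = _≈ᵥ_
    ; isEquivalence = record
      { refl = λ {v} → ≈ᵥ-refl {v} ; sym = λ {v} {w} → ≈ᵥ-sym {v} {w} ; trans = λ {u} {v} {w} → ≈ᵥ-trans {u} {v} {w} } }

  U↣V : Injection U V
  U↣V = record { to = inj₁ ; cong = id ; injective = id }

  module Bₘ m .(m≤n : m ≤ n) = Image {V} (P m m≤n) (inj₂ ∘ toTop m m≤n) (IsHom.cong (toTop-isHom m m≤n)) (toTop-injective m m≤n)

  x⇝toTop-ι : ∀ m .(m≤n : m ≤ n) (i : Fin m) x (p : mem (restrict A m≤n i) x) → x ⇝ toTop m m≤n (ι m m≤n i (x , p))
  x⇝toTop-ι m m≤n i x p = let i′ , p′ , toTop≈ιₙ = toTop-ι m m≤n i x p in i′ , p′ , Pₙ.sym toTop≈ιₙ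

  -- Only m ≤ n is constrained; beyond n the algebra is an arbitrary choice.
  B-dec : ∀ m → Dec (m ≤ n) → OnSub V
  B-dec m (yes m≤n) = Bₘ.onSub m m≤n
  B-dec m (no _)    = Bₘ.onSub 0 z≤n

  B : ℕ → OnSub V
  B m = B-dec m (m ≤? n)

  A⊆B-dec : ∀ m (m≤n : m ≤ n) (d : Dec (m ≤ n)) (i : Fin m) → SubAlgVia inj₁ (restrict A m≤n i) (B-dec m d)
  A⊆B-dec m _ (yes m≤n) i = SubAlgVia-fromHom
    (IsHom-∘ (InjectivePushout.ι-isHom (stage m m≤n) i) (Bₘ.toImage-isHom m m≤n))
    (λ (x , p) → x⇝toTop-ι m m≤n i x p)
  A⊆B-dec m m≤n (no m≰n) = ⊥-elim (m≰n m≤n)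

  A⊆B : ∀ j (j≤n : j ≤ n) (i : Fin j) → SubAlgVia inj₁ (restrict A j≤n i) (B j)
  A⊆B j j≤n = A⊆B-dec j j≤n (j ≤? n)

  B-pushout-dec : ∀ m (m≤n : m ≤ n) (d : Dec (m ≤ n)) →
    IsPushout (restrict A m≤n) (toBA (B-dec m d)) (λ i → SubAlgVia.inc (A⊆B-dec m m≤n d i))
  B-pushout-dec m _ (yes m≤n) =
    IsPushout-iso (InjectivePushout.isPushout (stage m m≤n)) (Bₘ.toImage-isHom m m≤n) (Bₘ.preimage-isHom m m≤n)
      (λ _ → BooleanAlgebra.refl (P m m≤n)) (Bₘ.toImage∘preimage≈id m m≤n) (λ i (x , p) → x⇝toTop-ι m m≤n i x p)
  B-pushout-dec m m≤n (no m≰n) = ⊥-elim (m≰n m≤n)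

  B-pushout : ∀ m (m≤n : m ≤ n) → IsPushout (restrict A m≤n) (toBA (B m)) (λ i → SubAlgVia.inc (A⊆B m m≤n i))
  B-pushout m m≤n = B-pushout-dec m m≤n (m ≤? n)

  B⊆B-dec : ∀ i j → i < j → j ≤ n → (dᵢ : Dec (i ≤ n)) (dⱼ : Dec (j ≤ n)) → SubAlgVia id (B-dec i dᵢ) (B-dec j dⱼ)
  B⊆B-dec i j i<j _ (yes i≤n) (yes j≤n) = SubAlgVia-fromHom
    (IsHom-∘ (Bₘ.preimage-isHom i i≤n) (IsHom-∘ (lift-isHom i≤′j i≤n j≤n) (Bₘ.toImage-isHom j j≤n)))
    (λ v → ≈ᵥ-trans {inj₂ _} {inj₂ _} {proj₁ v} (toTop∘lift≈toTop i≤′j i≤n j≤n (Bₘ.preimage i i≤n v))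
                                                 (Bₘ.toImage∘preimage≈id i i≤n v))
    where
    i≤′j : i ≤′ j
    i≤′j = ℕ.≤⇒≤′ (<⇒≤ i<j)
  B⊆B-dec i j i<j j≤n (no i≰n) _ = ⊥-elim (i≰n (ℕ.≤-trans (<⇒≤ i<j) j≤n))
  B⊆B-dec i j i<j j≤n (yes _) (no j≰n) = ⊥-elim (j≰n j≤n)

  B⊆B : ∀ i j → i < j → j ≤ n → SubAlgVia id (B i) (B j)
  B⊆B i j i<j j≤n = B⊆B-dec i j i<j j≤n (i ≤? n) (j ≤? n)

theorem3p53 : (U : Setoid 0ℓ 0ℓ) (n : ℕ) (A : Fin n → OnSub U) →
  Overlapping A →
  (∀ (m : Fin n) →
    CommReflects (restrict A (<⇒≤ (toℕ<n m))) (mem (A m))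
    × Commute (toBA (A m))
        (λ (i : Fin (toℕ m)) a → mem (restrict A (<⇒≤ (toℕ<n m)) i) (proj₁ a))) →
  Σ[ V ∈ Setoid 0ℓ 0ℓ ] Σ[ e ∈ Injection U V ] Σ[ B ∈ (ℕ → OnSub V) ]
  Σ[ AB ∈ (∀ (j : ℕ) (j≤n : j ≤ n) (i : Fin j) →
             SubAlgVia (Injection.to e) (restrict A j≤n i) (B j)) ]
    ((∀ (m : ℕ) (m≤n : m ≤ n) →
        IsPushout (restrict A m≤n) (toBA (B m))
          (λ i a → SubAlgVia.inc (AB m m≤n i) a))
     × (∀ (i j : ℕ) → i < j → j ≤ n → SubAlgVia id (B i) (B j)))
theorem3p53 U n A overlapping hypotheses = V , U↣V , B , A⊆B , B-pushout , B⊆B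
  where open Tower overlapping hypotheses
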